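{- There are absolute constants $\varepsilon>0$ and $\Delta_0$ such that the following holds. For every $\Delta\ge\Delta_0$, if $F=(V,E)$ is a multigraph with $\Delta(F)\le\Delta$, then for every $e\in E$ the neighbourhood $N_{L(F)^2}(e)$ induces a subgraph of $L(F)^2$ with at most $(1-\varepsilon)\binom{2\Delta(\Delta-1)}{2}$ edges.
   Context: Multigraphs are finite, loopless, and may have parallel edges; $\Delta(F)$ is the maximum degree (counting multiplicities). $L(F)$ is the line graph of $F$: the simple graph whose vertices are the edges of $F$, two distinct edges being adjacent iff they share an endpoint (so parallel edges are adjacent). For a graph $H$, $H^2$ has the same vertex set, with two distinct vertices adjacent iff their distance in $H$ is at most $2$. $N_{L(F)^2}(e)$ is the set of neighbours of $e$ in $L(F)^2$. -}

module Defs where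

open import Data.Nat using (ℕ; zero; suc; _+_; _≤_)
open import Data.Bool using (Bool; true; false; _∧_; _∨_; not; if_then_else_)
open import Data.Fin using (Fin; toℕ; _≟_)
import Data.Fin as F
open import Data.Product using (_×_; proj₁; proj₂)
open import Relation.Nullary.Decidable using (⌊_⌋)
open import Relation.Binary.PropositionalEquality using (_≢_)
import Data.Nat as N

count : ∀ {m} → (Fin m → Bool) → ℕ
count {zero}  p = 0
count {suc m} p = (if p F.zero then 1 else 0) + count (λ i → p (F.suc i))

sumF : ∀ {m} → (Fin m → ℕ) → ℕ
sumF {zero}  h = 0
sumF {suc m} h = h F.zero + sumF (λ i → h (F.suc i))

anyF : ∀ {m} → (Fin m → Bool) → Bool
anyF {zero}  p = false
anyF {suc m} p = p F.zero ∨ anyF (λ i → p (F.suc i))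

-- A finite loopless multigraph: vertices Fin n, edges Fin m (labelled, so
-- parallel edges are allowed), edge i has endpoints ends i (distinct).
record Multigraph : Set where
  field
    n : ℕ
    m : ℕ
    ends : Fin m → Fin n × Fin n
    loopless : ∀ i → proj₁ (ends i) ≢ proj₂ (ends i)

module _ (G : Multigraph) where
  open Multigraph G

  incident : Fin n → Fin m → Bool
  incident v i = ⌊ proj₁ (ends i) ≟ v ⌋ ∨ ⌊ proj₂ (ends i) ≟ v ⌋

  degree : Fin n → ℕ
  degree v = count (incident v)

  MaxDegree≤ : ℕ → Set
  MaxDegree≤ D = ∀ v → degree v ≤ D

  shareEnd : Fin m → Fin m → Bool
  shareEnd i j = incident (proj₁ (ends i)) j ∨ incident (proj₂ (ends i)) j

  adjL : Fin m → Fin m → Bool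
  adjL i j = not ⌊ i ≟ j ⌋ ∧ shareEnd i j

  adjL2 : Fin m → Fin m → Bool
  adjL2 i j = not ⌊ i ≟ j ⌋ ∧ (adjL i j ∨ anyF (λ k → adjL i k ∧ adjL k j))

  -- number of edges of the subgraph of L(F)^2 induced by N_{L(F)^2}(e)
  -- (unordered pairs {f,g} counted once, via toℕ f < toℕ g)
  inducedNbhdEdges : Fin m → ℕ
  inducedNbhdEdges e =
    sumF (λ f → count (λ g →
      ⌊ N.suc (toℕ f) N.≤? toℕ g ⌋ ∧ adjL2 e f ∧ adjL2 e g ∧ adjL2 f g))

module Submission where

open import Defs
open import Data.Nat using (ℕ; zero; suc; _+_; _*_; _∸_; _≤_; _≥_; z≤n; s≤s; _≤?_)
open import Data.Nat.Properties hiding (_≟_; suc-injective)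
open import Data.Nat.Tactic.RingSolver using (solve-∀)
open import Data.Nat.Combinatorics using (_C_; nCk+nC[k+1]≡[n+1]C[k+1]; nC1≡n)
open import Data.Bool using (Bool; true; false; T; _∧_; _∨_; not; if_then_else_)
open import Data.Bool.Properties using (T-∨; T-∧; ∨-comm; ∧-comm)
open import Function.Bundles using (Equivalence)
open import Data.Fin using (Fin; _≟_)
import Data.Fin as F
open import Data.Fin.Properties using (suc-injective)
open import Data.Sum using (_⊎_; inj₁; inj₂)
open import Data.Empty using (⊥; ⊥-elim)
open import Data.Product using (Σ; _,_; proj₁; proj₂; ∃; ∃₂; _×_)
open import Relation.Nullary.Decidable using (⌊_⌋; ⌊⌋-map′; yes; no; toWitness; fromWitness)
open import Relation.Nullary.Negation using (contradiction)
open import Relation.Binary.PropositionalEquality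
open import Data.Integer using (+_; +≤+)
import Data.Integer as ℤ
import Data.Integer.Properties as ℤP
open import Data.Rational using (ℚ; Positive; 1ℚ; _-_; _/_)
import Data.Rational as Q
import Data.Rational.Properties as ℚP
import Data.Rational.Unnormalised as ℚᵘ
import Data.Rational.Unnormalised.Properties as ℚᵘP
open import Algebra.Properties.Semiring.Sum +-*-semiring
  using (sum; sum-cong-≗; sum-replicate-zero; ∑-distrib-+; ∑-comm; *-distribˡ-sum; *-distribʳ-sum)

-- Write e = uv and S = N(u) ∪ N(v), so |S| ≤ 2Δ; every edge of F in N_{L(F)²}(e) has an endpoint
-- in S. For edges f, g touching S let links f g be the number of adjacent pairs (endpoint of f,
-- endpoint of g). An edge fg of the induced subgraph has links f g ≥ 1, so twice the number of
-- such edges plus the number C₄ of 4-cycles w x w′ x′ with w, w′ ∈ S and x, x′ ∉ S (these give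
-- pairs with links ≥ 2) is at most Σ links = Σ_a χ(a) d_S(a). Splitting this sum at S and using
-- AM–GM at the vertices outside S bounds it by (50Δ⁴ + 8ΔY)/16, where Y = Σ_{x∉S} |N(x) ∩ S|²,
-- while Cauchy–Schwarz gives Y² ≤ |S|² C₄ ≤ 4Δ² C₄. Eliminating Y and C₄ leaves at most 27Δ⁴/16
-- edges, which is below (15/16)·(2Δ(Δ−1) choose 2) once Δ ≥ 30; so ε = 1/16 and Δ₀ = 30.

𝟙 : Bool → ℕ
𝟙 b = if b then 1 else 0

𝟙≤1 : ∀ b → 𝟙 b ≤ 1
𝟙≤1 true  = ≤-refl
𝟙≤1 false = z≤n

𝟙-∧ : ∀ a b → 𝟙 (a ∧ b) ≡ 𝟙 a * 𝟙 b
𝟙-∧ true  b = sym (+-identityʳ (𝟙 b))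
𝟙-∧ false b = refl

𝟙-∨ : ∀ a b → 𝟙 (a ∨ b) ≤ 𝟙 a + 𝟙 b
𝟙-∨ true  b = s≤s z≤n
𝟙-∨ false b = ≤-refl

𝟙+𝟙-not : ∀ a → 𝟙 a + 𝟙 (not a) ≡ 1
𝟙+𝟙-not true  = refl
𝟙+𝟙-not false = refl

𝟙-T : ∀ {b} → T b → 𝟙 b ≡ 1
𝟙-T {true} _ = refl

𝟙≤ : ∀ {b n} → (T b → 1 ≤ n) → 𝟙 b ≤ n
𝟙≤ {true}  1≤n = 1≤n _
𝟙≤ {false} _   = z≤n

sumF≡sum : ∀ {m} (h : Fin m → ℕ) → sumF h ≡ sum h
sumF≡sum {zero}  h = refl
sumF≡sum {suc m} h = cong (_+_ (h F.zero)) (sumF≡sum (λ i → h (F.suc i)))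

count≡sum𝟙 : ∀ {m} (p : Fin m → Bool) → count p ≡ sum (λ i → 𝟙 (p i))
count≡sum𝟙 {zero}  p = refl
count≡sum𝟙 {suc m} p = cong (_+_ (𝟙 (p F.zero))) (count≡sum𝟙 (λ i → p (F.suc i)))

𝟙-anyF≤sum𝟙 : ∀ {m} (p : Fin m → Bool) → 𝟙 (anyF p) ≤ sum (λ i → 𝟙 (p i))
𝟙-anyF≤sum𝟙 {zero}  p = z≤n
𝟙-anyF≤sum𝟙 {suc m} p =
  ≤-trans (𝟙-∨ (p F.zero) _) (+-monoʳ-≤ (𝟙 (p F.zero)) (𝟙-anyF≤sum𝟙 (λ i → p (F.suc i))))

anyF-intro : ∀ {m} (p : Fin m → Bool) i → T (p i) → T (anyF p)
anyF-intro p F.zero    pi = Equivalence.from T-∨ (inj₁ pi)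
anyF-intro p (F.suc i) pi = Equivalence.from T-∨ (inj₂ (anyF-intro (λ j → p (F.suc j)) i pi))

anyF-elim : ∀ {m} (p : Fin m → Bool) → T (anyF p) → ∃ λ i → T (p i)
anyF-elim {suc m} p h with Equivalence.to T-∨ h
... | inj₁ p0 = F.zero , p0
... | inj₂ ps with anyF-elim (λ j → p (F.suc j)) ps
...   | i , pi = F.suc i , pi

anyF-cong : ∀ {m} {p q : Fin m → Bool} → (∀ i → p i ≡ q i) → anyF p ≡ anyF q
anyF-cong {zero}  p≗q = refl
anyF-cong {suc m} p≗q = cong₂ _∨_ (p≗q F.zero) (anyF-cong (λ i → p≗q (F.suc i)))

sum-mono-≤ : ∀ {m} {f g : Fin m → ℕ} → (∀ i → f i ≤ g i) → sum f ≤ sum g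
sum-mono-≤ {zero}  f≤g = z≤n
sum-mono-≤ {suc m} f≤g = +-mono-≤ (f≤g F.zero) (sum-mono-≤ (λ i → f≤g (F.suc i)))

sum-δ : ∀ {n} (x : Fin n) (φ : Fin n → ℕ) → sum (λ a → 𝟙 ⌊ x ≟ a ⌋ * φ a) ≡ φ x
sum-δ {suc n} F.zero φ = begin
  φ F.zero + 0 + sum {n} (λ _ → 0) ≡⟨ cong (_+_ (φ F.zero + 0)) (sum-replicate-zero n) ⟩
  φ F.zero + 0 + 0             ≡⟨ trans (+-identityʳ _) (+-identityʳ _) ⟩
  φ F.zero                     ∎
  where open ≡-Reasoning
sum-δ {suc n} (F.suc x) φ =
  trans (sum-cong-≗ (λ a → cong (λ b → 𝟙 b * φ (F.suc a)) (⌊⌋-map′ (cong F.suc) suc-injective (x ≟ a))))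
        (sum-δ x (λ a → φ (F.suc a)))

∑∑ : ∀ {m k} → (Fin m → Fin k → ℕ) → ℕ
∑∑ f = sum (λ i → sum (λ j → f i j))

∑∑-mono-≤ : ∀ {m k} {f g : Fin m → Fin k → ℕ} → (∀ i j → f i j ≤ g i j) → ∑∑ f ≤ ∑∑ g
∑∑-mono-≤ f≤g = sum-mono-≤ (λ i → sum-mono-≤ (f≤g i))

∑∑-distrib-+ : ∀ {m k} (f g : Fin m → Fin k → ℕ) → ∑∑ (λ i j → f i j + g i j) ≡ ∑∑ f + ∑∑ g
∑∑-distrib-+ f g =
  trans (sum-cong-≗ (λ i → ∑-distrib-+ (f i) (g i))) (∑-distrib-+ (λ i → sum (f i)) (λ i → sum (g i)))

*-distribˡ-∑∑ : ∀ {m k} c (f : Fin m → Fin k → ℕ) → c * ∑∑ f ≡ ∑∑ (λ i j → c * f i j)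
*-distribˡ-∑∑ c f = trans (*-distribˡ-sum c (λ i → sum (f i))) (sum-cong-≗ (λ i → *-distribˡ-sum c (f i)))

sum-*-sum : ∀ {m k} (f : Fin m → ℕ) (g : Fin k → ℕ) → sum f * sum g ≡ ∑∑ (λ i j → f i * g j)
sum-*-sum f g = trans (*-distribʳ-sum (sum g) f) (sum-cong-≗ (λ i → *-distribˡ-sum (f i) g))

square-gap : ∀ x d → 2 * (x * (x + d)) ≤ x * x + (x + d) * (x + d)
square-gap x d = subst (2 * (x * (x + d)) ≤_) (expand x d) (m≤m+n _ (d * d))
  where
  expand : ∀ x d → 2 * (x * (x + d)) + d * d ≡ x * x + (x + d) * (x + d)
  expand = solve-∀

am-gm : ∀ x y → 2 * (x * y) ≤ x * x + y * y
am-gm x y with ≤-total x y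
... | inj₁ x≤y = subst (λ z → 2 * (x * z) ≤ x * x + z * z) (m+[n∸m]≡n x≤y) (square-gap x (y ∸ x))
... | inj₂ y≤x = subst (λ z → 2 * (z * y) ≤ z * z + y * y) (m+[n∸m]≡n y≤x)
  (subst₂ _≤_ (cong (2 *_) (*-comm y _)) (+-comm (y * y) _) (square-gap y (x ∸ y)))

cauchy-schwarz : ∀ {m} (a x : Fin m → ℕ) →
  sum (λ i → a i * x i) * sum (λ i → a i * x i) ≤ sum a * sum (λ i → a i * (x i * x i))
cauchy-schwarz a x = *-cancelˡ-≤ 2 (begin
  2 * (sum ax * sum ax)                       ≡⟨ cong (2 *_) (sum-*-sum ax ax) ⟩
  2 * ∑∑ (λ i j → ax i * ax j)                ≡⟨ *-distribˡ-∑∑ 2 (λ i j → ax i * ax j) ⟩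
  ∑∑ (λ i j → 2 * (ax i * ax j))              ≤⟨ ∑∑-mono-≤ pointwise ⟩
  ∑∑ (λ i j → ax² i * a j + a i * ax² j)      ≡⟨ ∑∑-distrib-+ (λ i j → ax² i * a j) (λ i j → a i * ax² j) ⟩
  ∑∑ (λ i j → ax² i * a j) + ∑∑ (λ i j → a i * ax² j)
                                              ≡⟨ sym (cong₂ _+_ (sum-*-sum ax² a) (sum-*-sum a ax²)) ⟩
  sum ax² * sum a + sum a * sum ax²           ≡⟨ x*y+y*x≡2*[y*x] (sum ax²) (sum a) ⟩
  2 * (sum a * sum ax²)                       ∎)
  where
  open ≤-Reasoning
  ax ax² : Fin _ → ℕ
  ax i = a i * x i
  ax² i = a i * (x i * x i)
  x*y+y*x≡2*[y*x] : ∀ x y → x * y + y * x ≡ 2 * (y * x)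
  x*y+y*x≡2*[y*x] = solve-∀
  regroup₁ : ∀ a x b y → 2 * ((a * x) * (b * y)) ≡ (a * b) * (2 * (x * y))
  regroup₁ = solve-∀
  regroup₂ : ∀ a x b y → (a * b) * (x * x + y * y) ≡ (a * (x * x)) * b + a * (b * (y * y))
  regroup₂ = solve-∀
  pointwise : ∀ i j → 2 * (ax i * ax j) ≤ ax² i * a j + a i * ax² j
  pointwise i j = begin
    2 * (ax i * ax j)                   ≡⟨ regroup₁ (a i) (x i) (a j) (x j) ⟩
    (a i * a j) * (2 * (x i * x j))     ≤⟨ *-monoʳ-≤ (a i * a j) (am-gm (x i) (x j)) ⟩
    (a i * a j) * (x i * x i + x j * x j) ≡⟨ regroup₂ (a i) (x i) (a j) (x j) ⟩
    ax² i * a j + a i * ax² j           ∎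

∑∑-symmetric-≤ : ∀ {m} (w : Fin m → Fin m → ℕ) (x : Fin m → ℕ) → (∀ a b → w a b ≡ w b a) →
  ∑∑ (λ a b → w a b * (x a * x b)) ≤ sum (λ a → x a * x a * sum (w a))
∑∑-symmetric-≤ w x w-sym = *-cancelˡ-≤ 2 (begin
  2 * ∑∑ (λ a b → w a b * (x a * x b))       ≡⟨ *-distribˡ-∑∑ 2 (λ a b → w a b * (x a * x b)) ⟩
  ∑∑ (λ a b → 2 * (w a b * (x a * x b)))     ≤⟨ ∑∑-mono-≤ pointwise ⟩
  ∑∑ (λ a b → wx² a b + wx² b a)             ≡⟨ ∑∑-distrib-+ wx² (λ a b → wx² b a) ⟩
  ∑∑ wx² + ∑∑ (λ a b → wx² b a)              ≡⟨ cong (_+_ (∑∑ wx²)) (sym (∑-comm wx²)) ⟩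
  ∑∑ wx² + ∑∑ wx²                            ≡⟨ cong (_+_ (∑∑ wx²)) (sym (+-identityʳ (∑∑ wx²))) ⟩
  2 * ∑∑ wx²                                 ≡⟨ cong (2 *_) (sum-cong-≗ (λ a → sym (*-distribˡ-sum (x a * x a) (w a)))) ⟩
  2 * sum (λ a → x a * x a * sum (w a))      ∎)
  where
  open ≤-Reasoning
  wx² : Fin _ → Fin _ → ℕ
  wx² a b = x a * x a * w a b
  regroup : ∀ w x y → w * (x * x + y * y) ≡ x * x * w + y * y * w
  regroup = solve-∀
  pointwise : ∀ a b → 2 * (w a b * (x a * x b)) ≤ wx² a b + wx² b a
  pointwise a b = begin
    2 * (w a b * (x a * x b))           ≡⟨ x*[y*z]≡y*[x*z] 2 (w a b) (x a * x b) ⟩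
    w a b * (2 * (x a * x b))           ≤⟨ *-monoʳ-≤ (w a b) (am-gm (x a) (x b)) ⟩
    w a b * (x a * x a + x b * x b)     ≡⟨ regroup (w a b) (x a) (x b) ⟩
    x a * x a * w a b + x b * x b * w a b ≡⟨ cong (_+_ (wx² a b)) (cong (x b * x b *_) (w-sym a b)) ⟩
    wx² a b + wx² b a                   ∎
    where
    x*[y*z]≡y*[x*z] : ∀ x y z → x * (y * z) ≡ y * (x * z)
    x*[y*z]≡y*[x*z] = solve-∀

before : ∀ {m} → Fin m → Fin m → Bool
before i j = ⌊ suc (F.toℕ i) ≤? F.toℕ j ⌋

before-asym : ∀ {m} (i j : Fin m) → 𝟙 (before i j) + 𝟙 (before j i) ≤ 1
before-asym i j with suc (F.toℕ i) ≤? F.toℕ j | suc (F.toℕ j) ≤? F.toℕ i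
... | yes i<j | yes j<i = contradiction j<i (<-asym i<j)
... | yes _   | no _    = ≤-refl
... | no _    | yes _   = ≤-refl
... | no _    | no _    = z≤n

∑∑-before-≤ : ∀ {m} (K : Fin m → Fin m → ℕ) → (∀ i j → K i j ≡ K j i) →
  2 * ∑∑ (λ i j → 𝟙 (before i j) * K i j) ≤ ∑∑ K
∑∑-before-≤ K K-sym = begin
  2 * ∑∑ L                              ≡⟨ cong (_+_ (∑∑ L)) (+-identityʳ (∑∑ L)) ⟩
  ∑∑ L + ∑∑ L                           ≡⟨ cong (_+_ (∑∑ L)) L-transpose ⟩
  ∑∑ L + ∑∑ (λ i j → L j i)             ≡⟨ sym (∑∑-distrib-+ L (λ i j → L j i)) ⟩
  ∑∑ (λ i j → L i j + L j i)            ≤⟨ ∑∑-mono-≤ pointwise ⟩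
  ∑∑ K                                  ∎
  where
  open ≤-Reasoning
  L : Fin _ → Fin _ → ℕ
  L i j = 𝟙 (before i j) * K i j
  L-transpose : ∑∑ L ≡ ∑∑ (λ i j → L j i)
  L-transpose = ∑-comm L
  pointwise : ∀ i j → L i j + L j i ≤ K i j
  pointwise i j = begin
    𝟙 (before i j) * K i j + 𝟙 (before j i) * K j i ≡⟨ cong (_+_ (𝟙 (before i j) * K i j)) (cong (𝟙 (before j i) *_) (K-sym j i)) ⟩
    𝟙 (before i j) * K i j + 𝟙 (before j i) * K i j ≡⟨ sym (*-distribʳ-+ (K i j) (𝟙 (before i j)) _) ⟩
    (𝟙 (before i j) + 𝟙 (before j i)) * K i j     ≤⟨ *-monoˡ-≤ (K i j) (before-asym i j) ⟩
    1 * K i j                                     ≡⟨ *-identityˡ (K i j) ⟩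
    K i j                                         ∎

16[Δmt+m²k]≤9Δ²m+8Δt² : ∀ Δ m t k → m + k ≤ Δ →
  16 * (Δ * m * t + m * m * k) ≤ 9 * (Δ * Δ) * m + 8 * Δ * (t * t)
16[Δmt+m²k]≤9Δ²m+8Δt² Δ m t k m+k≤Δ = begin
  16 * (Δ * m * t + m * m * k)                 ≡⟨ regroup₁ Δ m t k ⟩
  8 * Δ * (2 * (m * t)) + 16 * (m * m * k)     ≤⟨ +-monoˡ-≤ _ (*-monoʳ-≤ (8 * Δ) (am-gm m t)) ⟩
  8 * Δ * (m * m + t * t) + 16 * (m * m * k)   ≡⟨ regroup₂ Δ m t k ⟩
  m * (m * (8 * Δ + 16 * k)) + 8 * Δ * (t * t) ≤⟨ +-monoˡ-≤ _ (*-monoʳ-≤ m m[8Δ+16k]≤9Δ²) ⟩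
  m * (9 * (Δ * Δ)) + 8 * Δ * (t * t)          ≡⟨ cong (_+ 8 * Δ * (t * t)) (*-comm m _) ⟩
  9 * (Δ * Δ) * m + 8 * Δ * (t * t)            ∎
  where
  open ≤-Reasoning
  regroup₁ : ∀ Δ m t k → 16 * (Δ * m * t + m * m * k) ≡ 8 * Δ * (2 * (m * t)) + 16 * (m * m * k)
  regroup₁ = solve-∀
  regroup₂ : ∀ Δ m t k → 8 * Δ * (m * m + t * t) + 16 * (m * m * k) ≡ m * (m * (8 * Δ + 16 * k)) + 8 * Δ * (t * t)
  regroup₂ = solve-∀
  r = Δ ∸ m
  m+r≡Δ : m + r ≡ Δ
  m+r≡Δ = m+[n∸m]≡n (≤-trans (m≤m+n m k) m+k≤Δ)
  k≤r : k ≤ r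
  k≤r = subst (_≤ r) (m+n∸m≡n m k) (∸-monoˡ-≤ m m+k≤Δ)
  expand₁ : ∀ m r → m * (8 * (m + r) + 16 * r) ≡ 8 * (m * m) + 18 * (m * r) + 2 * (m * (3 * r))
  expand₁ = solve-∀
  expand₂ : ∀ m r → 8 * (m * m) + 18 * (m * r) + (m * m + (3 * r) * (3 * r)) ≡ 9 * ((m + r) * (m + r))
  expand₂ = solve-∀
  m[8Δ+16k]≤9Δ² : m * (8 * Δ + 16 * k) ≤ 9 * (Δ * Δ)
  m[8Δ+16k]≤9Δ² = begin
    m * (8 * Δ + 16 * k)                     ≤⟨ *-monoʳ-≤ m (+-monoʳ-≤ (8 * Δ) (*-monoʳ-≤ 16 k≤r)) ⟩
    m * (8 * Δ + 16 * r)                     ≡⟨ cong (λ z → m * (8 * z + 16 * r)) (sym m+r≡Δ) ⟩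
    m * (8 * (m + r) + 16 * r)               ≡⟨ expand₁ m r ⟩
    8 * (m * m) + 18 * (m * r) + 2 * (m * (3 * r))
                                             ≤⟨ +-monoʳ-≤ (8 * (m * m) + 18 * (m * r)) (am-gm m (3 * r)) ⟩
    8 * (m * m) + 18 * (m * r) + (m * m + (3 * r) * (3 * r)) ≡⟨ expand₂ m r ⟩
    9 * ((m + r) * (m + r))                  ≡⟨ cong (λ z → 9 * (z * z)) m+r≡Δ ⟩
    9 * (Δ * Δ)                              ∎

absorb-cross-term : ∀ Δ U C Y →
  16 * (2 * U + C) ≤ 50 * (Δ * Δ * Δ * Δ) + 8 * Δ * Y → Y * Y ≤ (2 * Δ) * (2 * Δ) * C →
  16 * U ≤ 27 * (Δ * Δ * Δ * Δ)
absorb-cross-term zero U C Y upper _ =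
  ≤-trans (*-monoʳ-≤ 16 (≤-trans (m≤m+n U (U + 0)) (m≤m+n (2 * U) C))) upper
-- Scaled by 4Δ², AM–GM gives 2·(4Y)(4Δ³) ≤ 16Y² + 16Δ⁶, and 16Y² ≤ 64Δ²C cancels the C on the left.
absorb-cross-term Δ@(suc _) U C Y upper lower =
  *-cancelʳ-≤ (16 * U) (27 * Δ⁴) (8 * (Δ * Δ)) (+-cancelʳ-≤ (64 * (Δ * Δ) * C) _ _ (begin
    16 * U * (8 * (Δ * Δ)) + 64 * (Δ * Δ) * C            ≡⟨ regroup₁ U Δ C ⟩
    4 * (Δ * Δ) * (16 * (2 * U + C))                      ≤⟨ *-monoʳ-≤ (4 * (Δ * Δ)) upper ⟩
    4 * (Δ * Δ) * (50 * Δ⁴ + 8 * Δ * Y)                   ≡⟨ regroup₂ Δ Y ⟩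
    200 * (Δ³ * Δ³) + 2 * ((4 * Y) * (4 * Δ³))           ≤⟨ +-monoʳ-≤ (200 * (Δ³ * Δ³)) (am-gm (4 * Y) (4 * Δ³)) ⟩
    200 * (Δ³ * Δ³) + ((4 * Y) * (4 * Y) + (4 * Δ³) * (4 * Δ³)) ≡⟨ regroup₃ Y Δ³ ⟩
    216 * (Δ³ * Δ³) + 16 * (Y * Y)                        ≤⟨ +-monoʳ-≤ (216 * (Δ³ * Δ³)) (*-monoʳ-≤ 16 lower) ⟩
    216 * (Δ³ * Δ³) + 16 * ((2 * Δ) * (2 * Δ) * C)        ≡⟨ regroup₄ Δ C ⟩
    27 * Δ⁴ * (8 * (Δ * Δ)) + 64 * (Δ * Δ) * C            ∎))
  where
  open ≤-Reasoning
  Δ³ = Δ * Δ * Δ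
  Δ⁴ = Δ * Δ * Δ * Δ
  regroup₁ : ∀ U Δ C → 16 * U * (8 * (Δ * Δ)) + 64 * (Δ * Δ) * C ≡ 4 * (Δ * Δ) * (16 * (2 * U + C))
  regroup₁ = solve-∀
  regroup₂ : ∀ Δ Y → 4 * (Δ * Δ) * (50 * (Δ * Δ * Δ * Δ) + 8 * Δ * Y) ≡
                     200 * ((Δ * Δ * Δ) * (Δ * Δ * Δ)) + 2 * ((4 * Y) * (4 * (Δ * Δ * Δ)))
  regroup₂ = solve-∀
  regroup₃ : ∀ Y T → 200 * (T * T) + ((4 * Y) * (4 * Y) + (4 * T) * (4 * T)) ≡ 216 * (T * T) + 16 * (Y * Y)
  regroup₃ = solve-∀
  regroup₄ : ∀ Δ C → 216 * ((Δ * Δ * Δ) * (Δ * Δ * Δ)) + 16 * ((2 * Δ) * (2 * Δ) * C) ≡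
                     27 * (Δ * Δ * Δ * Δ) * (8 * (Δ * Δ)) + 64 * (Δ * Δ) * C
  regroup₄ = solve-∀

2*[nC2]≡n*[n∸1] : ∀ n → 2 * (n C 2) ≡ n * (n ∸ 1)
2*[nC2]≡n*[n∸1] zero    = refl
2*[nC2]≡n*[n∸1] (suc n) = begin
  2 * (suc n C 2)      ≡⟨ cong (2 *_) (sym (nCk+nC[k+1]≡[n+1]C[k+1] n 1)) ⟩
  2 * (n C 1 + n C 2)  ≡⟨ cong (λ z → 2 * (z + n C 2)) (nC1≡n n) ⟩
  2 * (n + n C 2)      ≡⟨ *-distribˡ-+ 2 n (n C 2) ⟩
  2 * n + 2 * (n C 2)  ≡⟨ cong (_+_ (2 * n)) (2*[nC2]≡n*[n∸1] n) ⟩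
  2 * n + n * (n ∸ 1)  ≡⟨ 2*n+n*[n∸1]≡[1+n]*n n ⟩
  suc n * n            ∎
  where
  open ≡-Reasoning
  2*n+n*[n∸1]≡[1+n]*n : ∀ n → 2 * n + n * (n ∸ 1) ≡ suc n * n
  2*n+n*[n∸1]≡[1+n]*n zero    = refl
  2*n+n*[n∸1]≡[1+n]*n (suc k) = identity k
    where
    identity : ∀ k → 2 * suc k + suc k * k ≡ suc (suc k) * suc k
    identity = solve-∀

27Δ⁴≤15*[2Δ[Δ∸1]C2] : ∀ Δ → 30 ≤ Δ → 27 * (Δ * Δ * Δ * Δ) ≤ 15 * ((2 * (Δ * (Δ ∸ 1))) C 2)
-- slack is 15·N·(N ∸ 1) − 54Δ⁴ expanded in j = Δ ∸ 30; all its coefficients are nonnegative.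
27Δ⁴≤15*[2Δ[Δ∸1]C2] Δ 30≤Δ = subst Claim (m∸n+n≡m 30≤Δ) (claim (Δ ∸ 30))
  where
  Claim : ℕ → Set
  Claim Δ = 27 * (Δ * Δ * Δ * Δ) ≤ 15 * ((2 * (Δ * (Δ ∸ 1))) C 2)
  expand : ∀ j → 2 * (27 * ((j + 30) * (j + 30) * (j + 30) * (j + 30))) +
                 (6 * (j * j * j * j) + 600 * (j * j * j) + 21630 * (j * j) + 325830 * j + 1647900) ≡
                 15 * ((2 * ((j + 30) * (j + 29))) * (2 * (j * j) + 118 * j + 1739))
  expand = solve-∀
  N≡1+M : ∀ j → 2 * ((j + 30) * (j + 29)) ≡ 1 + (2 * (j * j) + 118 * j + 1739)
  N≡1+M = solve-∀
  x*[y*z]≡y*[x*z] : ∀ x y z → x * (y * z) ≡ y * (x * z)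
  x*[y*z]≡y*[x*z] = solve-∀
  claim : ∀ j → Claim (j + 30)
  claim j rewrite +-∸-assoc j {30} {1} (s≤s z≤n) = *-cancelˡ-≤ 2 (begin
    2 * (27 * Δ⁴)           ≤⟨ m≤m+n (2 * (27 * Δ⁴)) slack ⟩
    2 * (27 * Δ⁴) + slack   ≡⟨ expand j ⟩
    15 * (N * M)            ≡⟨ cong (λ z → 15 * (N * z)) (sym (cong (_∸ 1) (N≡1+M j))) ⟩
    15 * (N * (N ∸ 1))      ≡⟨ cong (15 *_) (sym (2*[nC2]≡n*[n∸1] N)) ⟩
    15 * (2 * (N C 2))      ≡⟨ x*[y*z]≡y*[x*z] 15 2 (N C 2) ⟩
    2 * (15 * (N C 2))      ∎)
    where
    open ≤-Reasoning
    Δ⁴ = (j + 30) * (j + 30) * (j + 30) * (j + 30)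
    N = 2 * ((j + 30) * (j + 29))
    M = 2 * (j * j) + 118 * j + 1739
    slack = 6 * (j * j * j * j) + 600 * (j * j * j) + 21630 * (j * j) + 325830 * j + 1647900

atLeast₁ atLeast₂ : ℕ → ℕ
atLeast₁ zero    = 0
atLeast₁ (suc _) = 1
atLeast₂ zero          = 0
atLeast₂ (suc zero)    = 0
atLeast₂ (suc (suc _)) = 1

atLeast₁-pos : ∀ {x} → 1 ≤ x → atLeast₁ x ≡ 1
atLeast₁-pos (s≤s _) = refl

atLeast₁+atLeast₂≤id : ∀ x → atLeast₁ x + atLeast₂ x ≤ x
atLeast₁+atLeast₂≤id zero          = z≤n
atLeast₁+atLeast₂≤id (suc zero)    = s≤s z≤n
atLeast₁+atLeast₂≤id (suc (suc _)) = s≤s (s≤s z≤n)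

atLeast₂-mono : ∀ {x y} → x ≤ y → atLeast₂ x ≤ atLeast₂ y
atLeast₂-mono z≤n               = z≤n
atLeast₂-mono (s≤s z≤n)         = z≤n
atLeast₂-mono (s≤s (s≤s _))     = ≤-refl

x*y≤atLeast₂[x+y] : ∀ {x y} → x ≤ 1 → y ≤ 1 → x * y ≤ atLeast₂ (x + y)
x*y≤atLeast₂[x+y] z≤n       _         = z≤n
x*y≤atLeast₂[x+y] (s≤s z≤n) z≤n       = z≤n
x*y≤atLeast₂[x+y] (s≤s z≤n) (s≤s z≤n) = ≤-refl

module Adjacency (G : Multigraph) where
  open Multigraph G

  end₁ end₂ : Fin m → Fin n
  end₁ f = proj₁ (ends f)
  end₂ f = proj₂ (ends f)

  _≡ᵇ_ : Fin n → Fin n → Bool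
  a ≡ᵇ b = ⌊ a ≟ b ⌋

  incidence : Fin m → Fin n → ℕ
  incidence f a = 𝟙 (end₁ f ≡ᵇ a) + 𝟙 (end₂ f ≡ᵇ a)

  incidence≡𝟙-incident : ∀ f a → incidence f a ≡ 𝟙 (incident G a f)
  incidence≡𝟙-incident f a with end₁ f ≟ a | end₂ f ≟ a
  ... | yes refl | yes e₂≡e₁ = contradiction (sym e₂≡e₁) (loopless f)
  ... | yes _    | no _      = refl
  ... | no _     | yes _     = refl
  ... | no _     | no _      = refl

  degree≡∑incidence : ∀ a → degree G a ≡ sum (λ f → incidence f a)
  degree≡∑incidence a =
    trans (count≡sum𝟙 (λ f → incident G a f)) (sym (sum-cong-≗ (λ f → incidence≡𝟙-incident f a)))

  ∑-endpoints : ∀ (w : Fin m → ℕ) (φ : Fin n → ℕ) →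
    sum (λ f → w f * (φ (end₁ f) + φ (end₂ f))) ≡ sum (λ a → φ a * sum (λ f → w f * incidence f a))
  ∑-endpoints w φ = begin
    sum (λ f → w f * (φ (end₁ f) + φ (end₂ f)))         ≡⟨ sum-cong-≗ at-edge ⟩
    ∑∑ (λ f a → φ a * (w f * incidence f a))            ≡⟨ ∑-comm (λ f a → φ a * (w f * incidence f a)) ⟩
    ∑∑ (λ a f → φ a * (w f * incidence f a))            ≡⟨ sum-cong-≗ (λ a → sym (*-distribˡ-sum (φ a) (λ f → w f * incidence f a))) ⟩
    sum (λ a → φ a * sum (λ f → w f * incidence f a))   ∎
    where
    open ≡-Reasoning
    regroup : ∀ w x y z → w * (x * z + y * z) ≡ z * (w * (x + y))
    regroup = solve-∀
    at-edge : ∀ f → w f * (φ (end₁ f) + φ (end₂ f)) ≡ sum (λ a → φ a * (w f * incidence f a))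
    at-edge f = begin
      w f * (φ (end₁ f) + φ (end₂ f))
        ≡⟨ cong (w f *_) (sym (cong₂ _+_ (sum-δ (end₁ f) φ) (sum-δ (end₂ f) φ))) ⟩
      w f * (sum (λ a → 𝟙 (end₁ f ≡ᵇ a) * φ a) + sum (λ a → 𝟙 (end₂ f ≡ᵇ a) * φ a))
        ≡⟨ cong (w f *_) (sym (∑-distrib-+ (λ a → 𝟙 (end₁ f ≡ᵇ a) * φ a) (λ a → 𝟙 (end₂ f ≡ᵇ a) * φ a))) ⟩
      w f * sum (λ a → 𝟙 (end₁ f ≡ᵇ a) * φ a + 𝟙 (end₂ f ≡ᵇ a) * φ a)
        ≡⟨ *-distribˡ-sum (w f) (λ a → 𝟙 (end₁ f ≡ᵇ a) * φ a + 𝟙 (end₂ f ≡ᵇ a) * φ a) ⟩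
      sum (λ a → w f * (𝟙 (end₁ f ≡ᵇ a) * φ a + 𝟙 (end₂ f ≡ᵇ a) * φ a))
        ≡⟨ sum-cong-≗ (λ a → regroup (w f) (𝟙 (end₁ f ≡ᵇ a)) (𝟙 (end₂ f ≡ᵇ a)) (φ a)) ⟩
      sum (λ a → φ a * (w f * incidence f a)) ∎

  orientations : Fin m → Fin n → Fin n → ℕ
  orientations f a b = 𝟙 (end₁ f ≡ᵇ a) * 𝟙 (end₂ f ≡ᵇ b) + 𝟙 (end₂ f ≡ᵇ a) * 𝟙 (end₁ f ≡ᵇ b)

  ∑-orientations : ∀ f a (φ : Fin n → ℕ) →
    sum (λ b → orientations f a b * φ b) ≡ 𝟙 (end₁ f ≡ᵇ a) * φ (end₂ f) + 𝟙 (end₂ f ≡ᵇ a) * φ (end₁ f)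
  ∑-orientations f a φ = begin
    sum (λ b → orientations f a b * φ b)
      ≡⟨ sum-cong-≗ (λ b → regroup (𝟙 (end₁ f ≡ᵇ a)) (𝟙 (end₂ f ≡ᵇ b)) (𝟙 (end₂ f ≡ᵇ a)) (𝟙 (end₁ f ≡ᵇ b)) (φ b)) ⟩
    sum (λ b → 𝟙 (end₁ f ≡ᵇ a) * (𝟙 (end₂ f ≡ᵇ b) * φ b) + 𝟙 (end₂ f ≡ᵇ a) * (𝟙 (end₁ f ≡ᵇ b) * φ b))
      ≡⟨ ∑-distrib-+ (λ b → 𝟙 (end₁ f ≡ᵇ a) * (𝟙 (end₂ f ≡ᵇ b) * φ b)) (λ b → 𝟙 (end₂ f ≡ᵇ a) * (𝟙 (end₁ f ≡ᵇ b) * φ b)) ⟩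
    sum (λ b → 𝟙 (end₁ f ≡ᵇ a) * (𝟙 (end₂ f ≡ᵇ b) * φ b)) + sum (λ b → 𝟙 (end₂ f ≡ᵇ a) * (𝟙 (end₁ f ≡ᵇ b) * φ b))
      ≡⟨ sym (cong₂ _+_ (*-distribˡ-sum (𝟙 (end₁ f ≡ᵇ a)) (λ b → 𝟙 (end₂ f ≡ᵇ b) * φ b))
                        (*-distribˡ-sum (𝟙 (end₂ f ≡ᵇ a)) (λ b → 𝟙 (end₁ f ≡ᵇ b) * φ b))) ⟩
    𝟙 (end₁ f ≡ᵇ a) * sum (λ b → 𝟙 (end₂ f ≡ᵇ b) * φ b) + 𝟙 (end₂ f ≡ᵇ a) * sum (λ b → 𝟙 (end₁ f ≡ᵇ b) * φ b)
      ≡⟨ cong₂ (λ x y → 𝟙 (end₁ f ≡ᵇ a) * x + 𝟙 (end₂ f ≡ᵇ a) * y) (sum-δ (end₂ f) φ) (sum-δ (end₁ f) φ) ⟩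
    𝟙 (end₁ f ≡ᵇ a) * φ (end₂ f) + 𝟙 (end₂ f ≡ᵇ a) * φ (end₁ f) ∎
    where
    open ≡-Reasoning
    regroup : ∀ x y z w v → (x * y + z * w) * v ≡ x * (y * v) + z * (w * v)
    regroup = solve-∀

  Joins : Fin m → Fin n → Fin n → Bool
  Joins f a b = (end₁ f ≡ᵇ a ∧ end₂ f ≡ᵇ b) ∨ (end₂ f ≡ᵇ a ∧ end₁ f ≡ᵇ b)

  Joins-sym : ∀ f a b → Joins f a b ≡ Joins f b a
  Joins-sym f a b = trans (∨-comm (end₁ f ≡ᵇ a ∧ end₂ f ≡ᵇ b) _)
    (cong₂ _∨_ (∧-comm (end₂ f ≡ᵇ a) (end₁ f ≡ᵇ b)) (∧-comm (end₁ f ≡ᵇ a) (end₂ f ≡ᵇ b)))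

  𝟙-Joins≤orientations : ∀ f a b → 𝟙 (Joins f a b) ≤ orientations f a b
  𝟙-Joins≤orientations f a b = ≤-trans (𝟙-∨ (end₁ f ≡ᵇ a ∧ end₂ f ≡ᵇ b) _)
    (≤-reflexive (cong₂ _+_ (𝟙-∧ (end₁ f ≡ᵇ a) _) (𝟙-∧ (end₂ f ≡ᵇ a) _)))

  Adjacent : Fin n → Fin n → Bool
  Adjacent a b = anyF (λ f → Joins f a b)

  adj : Fin n → Fin n → ℕ
  adj a b = 𝟙 (Adjacent a b)

  adj-sym : ∀ a b → adj a b ≡ adj b a
  adj-sym a b = cong 𝟙 (anyF-cong (λ f → Joins-sym f a b))

  multiplicity : Fin n → Fin n → ℕ
  multiplicity a b = sum (λ f → orientations f a b)

  adj≤multiplicity : ∀ a b → adj a b ≤ multiplicity a b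
  adj≤multiplicity a b =
    ≤-trans (𝟙-anyF≤sum𝟙 (λ f → Joins f a b)) (sum-mono-≤ (λ f → 𝟙-Joins≤orientations f a b))

  ∑-adj-≤ : ∀ a (φ : Fin n → ℕ) →
    sum (λ b → adj a b * φ b) ≤ sum (λ f → 𝟙 (end₁ f ≡ᵇ a) * φ (end₂ f) + 𝟙 (end₂ f ≡ᵇ a) * φ (end₁ f))
  ∑-adj-≤ a φ = begin
    sum (λ b → adj a b * φ b)                   ≤⟨ sum-mono-≤ (λ b → *-monoˡ-≤ (φ b) (adj≤multiplicity a b)) ⟩
    sum (λ b → multiplicity a b * φ b)          ≡⟨ sum-cong-≗ (λ b → *-distribʳ-sum (φ b) (λ f → orientations f a b)) ⟩
    ∑∑ (λ b f → orientations f a b * φ b)       ≡⟨ ∑-comm (λ b f → orientations f a b * φ b) ⟩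
    ∑∑ (λ f b → orientations f a b * φ b)       ≡⟨ sum-cong-≗ (λ f → ∑-orientations f a φ) ⟩
    sum (λ f → 𝟙 (end₁ f ≡ᵇ a) * φ (end₂ f) + 𝟙 (end₂ f ≡ᵇ a) * φ (end₁ f)) ∎
    where open ≤-Reasoning

  ∑-edges : ∀ (ψ : Fin n → Fin n → ℕ) →
    sum (λ f → ψ (end₁ f) (end₂ f) + ψ (end₂ f) (end₁ f)) ≡ ∑∑ (λ a b → multiplicity a b * ψ a b)
  ∑-edges ψ = begin
    sum (λ f → ψ (end₁ f) (end₂ f) + ψ (end₂ f) (end₁ f))  ≡⟨ sum-cong-≗ (λ f → sym (at-edge f)) ⟩
    sum (λ f → ∑∑ (λ a b → orientations f a b * ψ a b))    ≡⟨ ∑-comm (λ f a → sum (λ b → orientations f a b * ψ a b)) ⟩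
    sum (λ a → sum (λ f → sum (λ b → orientations f a b * ψ a b))) ≡⟨ sum-cong-≗ (λ a → ∑-comm (λ f b → orientations f a b * ψ a b)) ⟩
    ∑∑ (λ a b → sum (λ f → orientations f a b * ψ a b))    ≡⟨ sum-cong-≗ (λ a → sum-cong-≗ (λ b → sym (*-distribʳ-sum (ψ a b) (λ f → orientations f a b)))) ⟩
    ∑∑ (λ a b → multiplicity a b * ψ a b)                  ∎
    where
    open ≡-Reasoning
    at-edge : ∀ f → ∑∑ (λ a b → orientations f a b * ψ a b) ≡ ψ (end₁ f) (end₂ f) + ψ (end₂ f) (end₁ f)
    at-edge f = begin
      ∑∑ (λ a b → orientations f a b * ψ a b)    ≡⟨ sum-cong-≗ (λ a → ∑-orientations f a (ψ a)) ⟩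
      sum (λ a → 𝟙 (end₁ f ≡ᵇ a) * ψ a (end₂ f) + 𝟙 (end₂ f ≡ᵇ a) * ψ a (end₁ f))
        ≡⟨ ∑-distrib-+ (λ a → 𝟙 (end₁ f ≡ᵇ a) * ψ a (end₂ f)) (λ a → 𝟙 (end₂ f ≡ᵇ a) * ψ a (end₁ f)) ⟩
      _                                          ≡⟨ cong₂ _+_ (sum-δ (end₁ f) (λ a → ψ a (end₂ f))) (sum-δ (end₂ f) (λ a → ψ a (end₁ f))) ⟩
      ψ (end₁ f) (end₂ f) + ψ (end₂ f) (end₁ f)  ∎

  End : Fin n → Fin m → Set
  End a f = a ≡ end₁ f ⊎ a ≡ end₂ f

  Close : Fin m → Fin m → Set
  Close i j = ∃₂ λ a b → End a i × End b j × T (Adjacent a b)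

  adjacent-ends : ∀ {a b f} → End a f → End b f → a ≢ b → T (Adjacent a b)
  adjacent-ends {f = f} (inj₁ refl) (inj₁ refl) a≢b = contradiction refl a≢b
  adjacent-ends {f = f} (inj₁ refl) (inj₂ refl) _   =
    anyF-intro (λ g → Joins g (end₁ f) (end₂ f)) f
      (Equivalence.from (T-∨ {end₁ f ≡ᵇ end₁ f ∧ end₂ f ≡ᵇ end₂ f}) (inj₁ (Equivalence.from (T-∧ {end₁ f ≡ᵇ end₁ f}) (fromWitness refl , fromWitness refl))))
  adjacent-ends {f = f} (inj₂ refl) (inj₁ refl) _   =
    anyF-intro (λ g → Joins g (end₂ f) (end₁ f)) f
      (Equivalence.from (T-∨ {end₁ f ≡ᵇ end₂ f ∧ end₂ f ≡ᵇ end₁ f}) (inj₂ (Equivalence.from (T-∧ {end₂ f ≡ᵇ end₂ f}) (fromWitness refl , fromWitness refl))))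
  adjacent-ends {f = f} (inj₂ refl) (inj₂ refl) a≢b = contradiction refl a≢b

  common-end⇒Close : ∀ {x i j} → End x i → End x j → Close i j
  common-end⇒Close {i = i} x∈i@(inj₁ refl) x∈j =
    end₂ i , _ , inj₂ refl , x∈j , adjacent-ends (inj₂ refl) x∈i (λ e₂≡e₁ → loopless i (sym e₂≡e₁))
  common-end⇒Close {i = i} x∈i@(inj₂ refl) x∈j =
    end₁ i , _ , inj₁ refl , x∈j , adjacent-ends (inj₁ refl) x∈i (loopless i)

  incident⇒End : ∀ {x j} → T (incident G x j) → End x j
  incident⇒End {x} {j} h with Equivalence.to (T-∨ {end₁ j ≡ᵇ x}) h
  ... | inj₁ e₁≡x = inj₁ (sym (toWitness e₁≡x))
  ... | inj₂ e₂≡x = inj₂ (sym (toWitness e₂≡x))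

  L-adjacent⇒common-end : ∀ {i j} → T (adjL G i j) → ∃ λ x → End x i × End x j
  L-adjacent⇒common-end {i} h with Equivalence.to T-∨ (proj₂ (Equivalence.to T-∧ h))
  ... | inj₁ e₁∈j = end₁ i , inj₁ refl , incident⇒End e₁∈j
  ... | inj₂ e₂∈j = end₂ i , inj₂ refl , incident⇒End e₂∈j

  L-path⇒Close : ∀ {i k j} → T (adjL G i k) → T (adjL G k j) → Close i j
  L-path⇒Close ik kj with L-adjacent⇒common-end ik | L-adjacent⇒common-end kj
  ... | x , x∈i , x∈k | y , y∈k , y∈j with x ≟ y
  ...   | yes refl = common-end⇒Close x∈i y∈j
  ...   | no x≢y   = x , y , x∈i , y∈j , adjacent-ends x∈k y∈k x≢y

  L²-adjacent⇒Close : ∀ {i j} → T (adjL2 G i j) → Close i j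
  L²-adjacent⇒Close {i} {j} h with Equivalence.to T-∨ (proj₂ (Equivalence.to T-∧ h))
  ... | inj₁ ij = let x , x∈i , x∈j = L-adjacent⇒common-end ij in common-end⇒Close x∈i x∈j
  L²-adjacent⇒Close {i} {j} h | inj₂ path with anyF-elim (λ k → adjL G i k ∧ adjL G k j) path
  ...   | k , ikj = L-path⇒Close (proj₁ (Equivalence.to (T-∧ {adjL G i k}) ikj)) (proj₂ (Equivalence.to (T-∧ {adjL G i k}) ikj))

  links : Fin m → Fin m → ℕ
  links i j = adj (end₁ i) (end₁ j) + adj (end₁ i) (end₂ j) + adj (end₂ i) (end₁ j) + adj (end₂ i) (end₂ j)

  links-sym : ∀ i j → links i j ≡ links j i
  links-sym i j
    rewrite adj-sym (end₁ i) (end₁ j) | adj-sym (end₁ i) (end₂ j) | adj-sym (end₂ i) (end₁ j) | adj-sym (end₂ i) (end₂ j) =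
    swap-middle (adj (end₁ j) (end₁ i)) (adj (end₂ j) (end₁ i)) (adj (end₁ j) (end₂ i)) (adj (end₂ j) (end₂ i))
    where
    swap-middle : ∀ a b c d → a + b + c + d ≡ a + c + b + d
    swap-middle = solve-∀

  adj≤links : ∀ {a b i j} → End a i → End b j → adj a b ≤ links i j
  adj≤links {i = i} {j} (inj₁ refl) (inj₁ refl) =
    ≤-trans (m≤m+n _ (adj (end₁ i) (end₂ j))) (≤-trans (m≤m+n _ (adj (end₂ i) (end₁ j))) (m≤m+n _ (adj (end₂ i) (end₂ j))))
  adj≤links {i = i} {j} (inj₁ refl) (inj₂ refl) =
    ≤-trans (m≤n+m _ (adj (end₁ i) (end₁ j))) (≤-trans (m≤m+n _ (adj (end₂ i) (end₁ j))) (m≤m+n _ (adj (end₂ i) (end₂ j))))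
  adj≤links {i = i} {j} (inj₂ refl) (inj₁ refl) =
    ≤-trans (m≤n+m _ (adj (end₁ i) (end₁ j) + adj (end₁ i) (end₂ j))) (m≤m+n _ (adj (end₂ i) (end₂ j)))
  adj≤links {i = i} {j} (inj₂ refl) (inj₂ refl) = m≤n+m _ _

  Close⇒1≤links : ∀ {i j} → Close i j → 1 ≤ links i j
  Close⇒1≤links (a , b , a∈i , b∈j , a~b) = ≤-trans (≤-reflexive (sym (𝟙-T a~b))) (adj≤links a∈i b∈j)

module BoundedDegree (G : Multigraph) {Δ : ℕ} (Δ-bound : MaxDegree≤ G Δ) where
  open Multigraph G
  open Adjacency G

  ∑incidence≤Δ : ∀ a → sum (λ f → incidence f a) ≤ Δ
  ∑incidence≤Δ a = ≤-trans (≤-reflexive (sym (degree≡∑incidence a))) (Δ-bound a)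

  ∑-adj-≤-Δ* : ∀ a (φ : Fin n → ℕ) B → (∀ b → φ b ≤ B) → sum (λ b → adj a b * φ b) ≤ Δ * B
  ∑-adj-≤-Δ* a φ B φ≤B = begin
    sum (λ b → adj a b * φ b)
      ≤⟨ ∑-adj-≤ a φ ⟩
    sum (λ f → 𝟙 (end₁ f ≡ᵇ a) * φ (end₂ f) + 𝟙 (end₂ f ≡ᵇ a) * φ (end₁ f))
      ≤⟨ sum-mono-≤ (λ f → +-mono-≤ (*-monoʳ-≤ (𝟙 (end₁ f ≡ᵇ a)) (φ≤B (end₂ f))) (*-monoʳ-≤ (𝟙 (end₂ f ≡ᵇ a)) (φ≤B (end₁ f)))) ⟩
    sum (λ f → 𝟙 (end₁ f ≡ᵇ a) * B + 𝟙 (end₂ f ≡ᵇ a) * B)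
      ≡⟨ sum-cong-≗ (λ f → sym (*-distribʳ-+ B (𝟙 (end₁ f ≡ᵇ a)) (𝟙 (end₂ f ≡ᵇ a)))) ⟩
    sum (λ f → incidence f a * B)
      ≡⟨ sym (*-distribʳ-sum B (λ f → incidence f a)) ⟩
    sum (λ f → incidence f a) * B
      ≤⟨ *-monoˡ-≤ B (∑incidence≤Δ a) ⟩
    Δ * B ∎
    where open ≤-Reasoning

  ∑adj≤Δ : ∀ a → sum (adj a) ≤ Δ
  ∑adj≤Δ a = begin
    sum (adj a)               ≡⟨ sum-cong-≗ (λ b → sym (*-identityʳ (adj a b))) ⟩
    sum (λ b → adj a b * 1)   ≤⟨ ∑-adj-≤-Δ* a (λ _ → 1) 1 (λ _ → ≤-refl) ⟩
    Δ * 1                     ≡⟨ *-identityʳ Δ ⟩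
    Δ                         ∎
    where open ≤-Reasoning

module AroundEdge (G : Multigraph) (e : Fin (Multigraph.m G)) where
  open Multigraph G
  open Adjacency G

  S : Fin n → Bool
  S a = Adjacent (end₁ e) a ∨ Adjacent (end₂ e) a

  inS outS : Fin n → ℕ
  inS a = 𝟙 (S a)
  outS a = 𝟙 (not (S a))

  TouchesS : Fin m → Bool
  TouchesS f = S (end₁ f) ∨ S (end₂ f)

  touchesS : Fin m → ℕ
  touchesS f = 𝟙 (TouchesS f)

  Close-e⇒TouchesS : ∀ {g} → Close e g → T (TouchesS g)
  Close-e⇒TouchesS (a , b , a∈e , b∈g , a~b) =
    b∈g⇒TouchesS b∈g (Equivalence.from (T-∨ {Adjacent (end₁ e) b}) (a∈e⇒S a∈e))
    where
    a∈e⇒S : End a e → T (Adjacent (end₁ e) b) ⊎ T (Adjacent (end₂ e) b)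
    a∈e⇒S (inj₁ refl) = inj₁ a~b
    a∈e⇒S (inj₂ refl) = inj₂ a~b
    b∈g⇒TouchesS : ∀ {g} → End b g → T (S b) → T (TouchesS g)
    b∈g⇒TouchesS {g} (inj₁ refl) Sb = Equivalence.from (T-∨ {S (end₁ g)}) (inj₁ Sb)
    b∈g⇒TouchesS {g} (inj₂ refl) Sb = Equivalence.from (T-∨ {S (end₁ g)}) (inj₂ Sb)

  linked doublyLinked totalLinks : Fin m → Fin m → ℕ
  linked      f g = touchesS f * touchesS g * atLeast₁ (links f g)
  doublyLinked f g = touchesS f * touchesS g * atLeast₂ (links f g)
  totalLinks  f g = touchesS f * touchesS g * links f g

  linked-sym : ∀ f g → linked f g ≡ linked g f
  linked-sym f g rewrite links-sym f g = cong (_* atLeast₁ (links g f)) (*-comm (touchesS f) (touchesS g))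

  L²-triangle⇒linked : ∀ {f g} → T (adjL2 G e f) → T (adjL2 G e g) → T (adjL2 G f g) → linked f g ≡ 1
  L²-triangle⇒linked {f} {g} ef eg fg
    rewrite 𝟙-T (Close-e⇒TouchesS (L²-adjacent⇒Close ef)) | 𝟙-T (Close-e⇒TouchesS (L²-adjacent⇒Close eg))
    = trans (+-identityʳ _) (atLeast₁-pos (Close⇒1≤links (L²-adjacent⇒Close fg)))

  2*inducedNbhdEdges≤∑∑linked : 2 * inducedNbhdEdges G e ≤ ∑∑ linked
  2*inducedNbhdEdges≤∑∑linked = begin
    2 * inducedNbhdEdges G e                     ≡⟨ cong (2 *_) as-double-sum ⟩
    2 * ∑∑ (λ f g → 𝟙 (Edge f g))                ≤⟨ *-monoʳ-≤ 2 (∑∑-mono-≤ pointwise) ⟩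
    2 * ∑∑ (λ f g → 𝟙 (before f g) * linked f g) ≤⟨ ∑∑-before-≤ linked linked-sym ⟩
    ∑∑ linked                                    ∎
    where
    open ≤-Reasoning
    Edge : Fin m → Fin m → Bool
    Edge f g = before f g ∧ adjL2 G e f ∧ adjL2 G e g ∧ adjL2 G f g
    as-double-sum : inducedNbhdEdges G e ≡ ∑∑ (λ f g → 𝟙 (Edge f g))
    as-double-sum = trans (sumF≡sum (λ f → count (Edge f))) (sum-cong-≗ (λ f → count≡sum𝟙 (Edge f)))
    pointwise : ∀ f g → 𝟙 (Edge f g) ≤ 𝟙 (before f g) * linked f g
    pointwise f g = 𝟙≤ {Edge f g} λ h →
      let f<g , rest = Equivalence.to (T-∧ {before f g}) h
          ef , rest′ = Equivalence.to (T-∧ {adjL2 G e f}) rest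
          eg , fg    = Equivalence.to (T-∧ {adjL2 G e g}) rest′
      in ≤-reflexive (sym (cong₂ _*_ (𝟙-T f<g) (L²-triangle⇒linked ef eg fg)))

  ∑∑linked+∑∑doublyLinked≤∑∑totalLinks : ∑∑ linked + ∑∑ doublyLinked ≤ ∑∑ totalLinks
  ∑∑linked+∑∑doublyLinked≤∑∑totalLinks = begin
    ∑∑ linked + ∑∑ doublyLinked                  ≡⟨ sym (∑∑-distrib-+ linked doublyLinked) ⟩
    ∑∑ (λ f g → linked f g + doublyLinked f g)   ≤⟨ ∑∑-mono-≤ pointwise ⟩
    ∑∑ totalLinks                                ∎
    where
    open ≤-Reasoning
    pointwise : ∀ f g → linked f g + doublyLinked f g ≤ totalLinks f g
    pointwise f g = ≤-trans (≤-reflexive (sym (*-distribˡ-+ (touchesS f * touchesS g) _ _)))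
                            (*-monoʳ-≤ (touchesS f * touchesS g) (atLeast₁+atLeast₂≤id (links f g)))

  degS : Fin n → ℕ
  degS a = sum (λ f → touchesS f * incidence f a)

  χ : Fin n → ℕ
  χ a = sum (λ b → adj a b * degS b)

  ∑∑totalLinks≡∑χ*degS : ∑∑ totalLinks ≡ sum (λ a → χ a * degS a)
  ∑∑totalLinks≡∑χ*degS = begin
    ∑∑ totalLinks                                     ≡⟨ sum-cong-≗ row ⟩
    sum (λ f → touchesS f * (χ (end₁ f) + χ (end₂ f))) ≡⟨ ∑-endpoints touchesS χ ⟩
    sum (λ a → χ a * degS a)                          ∎
    where
    open ≡-Reasoning
    ψ : Fin m → Fin n → ℕ
    ψ f b = adj (end₁ f) b + adj (end₂ f) b
    regroup : ∀ s t a b c d → s * t * (a + b + c + d) ≡ s * (t * ((a + c) + (b + d)))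
    regroup = solve-∀
    row : ∀ f → sum (totalLinks f) ≡ touchesS f * (χ (end₁ f) + χ (end₂ f))
    row f = begin
      sum (totalLinks f)
        ≡⟨ sum-cong-≗ (λ g → regroup (touchesS f) (touchesS g) (adj (end₁ f) (end₁ g)) (adj (end₁ f) (end₂ g))
                                      (adj (end₂ f) (end₁ g)) (adj (end₂ f) (end₂ g))) ⟩
      sum (λ g → touchesS f * (touchesS g * (ψ f (end₁ g) + ψ f (end₂ g))))
        ≡⟨ sym (*-distribˡ-sum (touchesS f) (λ g → touchesS g * (ψ f (end₁ g) + ψ f (end₂ g)))) ⟩
      touchesS f * sum (λ g → touchesS g * (ψ f (end₁ g) + ψ f (end₂ g)))
        ≡⟨ cong (touchesS f *_) (∑-endpoints touchesS (ψ f)) ⟩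
      touchesS f * sum (λ b → ψ f b * degS b)
        ≡⟨ cong (touchesS f *_) (sum-cong-≗ (λ b → *-distribʳ-+ (degS b) (adj (end₁ f) b) (adj (end₂ f) b))) ⟩
      touchesS f * sum (λ b → adj (end₁ f) b * degS b + adj (end₂ f) b * degS b)
        ≡⟨ cong (touchesS f *_) (∑-distrib-+ (λ b → adj (end₁ f) b * degS b) (λ b → adj (end₂ f) b * degS b)) ⟩
      touchesS f * (χ (end₁ f) + χ (end₂ f)) ∎

  split-S : ∀ (h : Fin n → ℕ) → sum h ≡ sum (λ a → inS a * h a) + sum (λ a → outS a * h a)
  split-S h = trans (sum-cong-≗ (λ a → sym (trans (sym (*-distribʳ-+ (h a) (inS a) (outS a)))
                                                  (trans (cong (_* h a) (𝟙+𝟙-not (S a))) (*-identityˡ (h a))))))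
                    (∑-distrib-+ (λ a → inS a * h a) (λ a → outS a * h a))

  inNbrs outNbrs : Fin n → ℕ
  inNbrs a = sum (λ b → inS b * adj a b)
  outNbrs a = sum (λ b → outS b * adj a b)

  P Y : ℕ
  P = sum (λ a → outS a * degS a)
  Y = sum (λ a → outS a * (inNbrs a * inNbrs a))

  χout : Fin n → ℕ
  χout a = sum (λ b → outS b * (adj a b * degS b))

  outsideLinks : Fin n → Fin n → ℕ
  outsideLinks a b = outS a * outS b * adj a b

  outsideLinks-sym : ∀ a b → outsideLinks a b ≡ outsideLinks b a
  outsideLinks-sym a b rewrite adj-sym a b = cong (_* adj b a) (*-comm (outS a) (outS b))

  ∑outS*χout*degS≤ : sum (λ a → outS a * (χout a * degS a)) ≤ sum (λ a → outS a * (degS a * degS a * outNbrs a))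
  ∑outS*χout*degS≤ = begin
    sum (λ a → outS a * (χout a * degS a))                        ≡⟨ sum-cong-≗ as-double-sum ⟩
    ∑∑ (λ a b → outsideLinks a b * (degS a * degS b))             ≤⟨ ∑∑-symmetric-≤ outsideLinks degS outsideLinks-sym ⟩
    sum (λ a → degS a * degS a * sum (outsideLinks a))            ≡⟨ sum-cong-≗ pull-outS ⟩
    sum (λ a → outS a * (degS a * degS a * outNbrs a))            ∎
    where
    open ≤-Reasoning
    regroup₁ : ∀ oa ob x da db → oa * (ob * (x * db) * da) ≡ oa * ob * x * (da * db)
    regroup₁ = solve-∀
    regroup₂ : ∀ d o s → d * d * (o * s) ≡ o * (d * d * s)
    regroup₂ = solve-∀
    as-double-sum : ∀ a → outS a * (χout a * degS a) ≡ sum (λ b → outsideLinks a b * (degS a * degS b))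
    as-double-sum a = begin-equality
      outS a * (χout a * degS a)
        ≡⟨ cong (outS a *_) (*-distribʳ-sum (degS a) (λ b → outS b * (adj a b * degS b))) ⟩
      outS a * sum (λ b → outS b * (adj a b * degS b) * degS a)
        ≡⟨ *-distribˡ-sum (outS a) (λ b → outS b * (adj a b * degS b) * degS a) ⟩
      sum (λ b → outS a * (outS b * (adj a b * degS b) * degS a))
        ≡⟨ sum-cong-≗ (λ b → regroup₁ (outS a) (outS b) (adj a b) (degS a) (degS b)) ⟩
      sum (λ b → outsideLinks a b * (degS a * degS b)) ∎
    pull-outS : ∀ a → degS a * degS a * sum (outsideLinks a) ≡ outS a * (degS a * degS a * outNbrs a)
    pull-outS a = begin-equality
      degS a * degS a * sum (outsideLinks a)
        ≡⟨ cong (degS a * degS a *_) (sum-cong-≗ (λ b → *-assoc (outS a) (outS b) (adj a b))) ⟩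
      degS a * degS a * sum (λ b → outS a * (outS b * adj a b))
        ≡⟨ cong (degS a * degS a *_) (sym (*-distribˡ-sum (outS a) (λ b → outS b * adj a b))) ⟩
      degS a * degS a * (outS a * outNbrs a)
        ≡⟨ regroup₂ (degS a) (outS a) (outNbrs a) ⟩
      outS a * (degS a * degS a * outNbrs a) ∎

  common : Fin n → Fin n → ℕ
  common w w′ = sum (λ x → outS x * adj w x * adj w′ x)

  C4 : ℕ
  C4 = sum (λ w → inS w * sum (λ w′ → inS w′ * (common w w′ * common w w′)))

  Y≡∑inS*∑inS*common : Y ≡ sum (λ w → inS w * sum (λ w′ → inS w′ * common w w′))
  Y≡∑inS*∑inS*common = sym (begin
    sum (λ w → inS w * sum (λ w′ → inS w′ * common w w′))
      ≡⟨ sum-cong-≗ (λ w → trans (*-distribˡ-sum (inS w) (λ w′ → inS w′ * common w w′))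
                                 (sum-cong-≗ (λ w′ → trans (cong (inS w *_) (*-distribˡ-sum (inS w′) (λ x → outS x * adj w x * adj w′ x)))
                                                           (*-distribˡ-sum (inS w) (λ x → inS w′ * (outS x * adj w x * adj w′ x)))))) ⟩
    sum (λ w → ∑∑ (λ w′ x → term w w′ x))          ≡⟨ sum-cong-≗ (λ w → ∑-comm (term w)) ⟩
    sum (λ w → ∑∑ (λ x w′ → term w w′ x))          ≡⟨ ∑-comm (λ w x → sum (λ w′ → term w w′ x)) ⟩
    sum (λ x → ∑∑ (λ w w′ → term w w′ x))          ≡⟨ sum-cong-≗ at-x ⟩
    Y                                              ∎)
    where
    open ≡-Reasoning
    term : Fin n → Fin n → Fin n → ℕ
    term w w′ x = inS w * (inS w′ * (outS x * adj w x * adj w′ x))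
    regroup : ∀ s s′ o a a′ → s * (s′ * (o * a * a′)) ≡ o * ((s * a) * (s′ * a′))
    regroup = solve-∀
    at-x : ∀ x → ∑∑ (λ w w′ → term w w′ x) ≡ outS x * (inNbrs x * inNbrs x)
    at-x x = begin
      ∑∑ (λ w w′ → term w w′ x)
        ≡⟨ sum-cong-≗ (λ w → sum-cong-≗ (λ w′ → trans (regroup (inS w) (inS w′) (outS x) (adj w x) (adj w′ x))
                                                      (cong₂ (λ y z → outS x * ((inS w * y) * (inS w′ * z))) (adj-sym w x) (adj-sym w′ x)))) ⟩
      ∑∑ (λ w w′ → outS x * ((inS w * adj x w) * (inS w′ * adj x w′)))
        ≡⟨ sym (*-distribˡ-∑∑ (outS x) (λ w w′ → (inS w * adj x w) * (inS w′ * adj x w′))) ⟩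
      outS x * ∑∑ (λ w w′ → (inS w * adj x w) * (inS w′ * adj x w′))
        ≡⟨ cong (outS x *_) (sym (sum-*-sum (λ w → inS w * adj x w) (λ w′ → inS w′ * adj x w′))) ⟩
      outS x * (inNbrs x * inNbrs x) ∎

  Y²≤|S|²*C4 : Y * Y ≤ sum inS * sum inS * C4
  Y²≤|S|²*C4 = begin
    Y * Y                                             ≡⟨ cong₂ _*_ Y≡∑inS*∑inS*common Y≡∑inS*∑inS*common ⟩
    sum (λ w → inS w * Z w) * sum (λ w → inS w * Z w) ≤⟨ cauchy-schwarz inS Z ⟩
    sum inS * sum (λ w → inS w * (Z w * Z w))         ≤⟨ *-monoʳ-≤ (sum inS) (sum-mono-≤ (λ w → *-monoʳ-≤ (inS w) (cauchy-schwarz inS (common w)))) ⟩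
    sum inS * sum (λ w → inS w * (sum inS * C4ʷ w))   ≡⟨ cong (sum inS *_) (sum-cong-≗ (λ w → x*[y*z]≡y*[x*z] (inS w) (sum inS) (C4ʷ w))) ⟩
    sum inS * sum (λ w → sum inS * (inS w * C4ʷ w))   ≡⟨ cong (sum inS *_) (sym (*-distribˡ-sum (sum inS) (λ w → inS w * C4ʷ w))) ⟩
    sum inS * (sum inS * C4)                          ≡⟨ sym (*-assoc (sum inS) (sum inS) C4) ⟩
    sum inS * sum inS * C4                            ∎
    where
    open ≤-Reasoning
    Z C4ʷ : Fin n → ℕ
    Z w = sum (λ w′ → inS w′ * common w w′)
    C4ʷ w = sum (λ w′ → inS w′ * (common w w′ * common w w′))
    x*[y*z]≡y*[x*z] : ∀ x y z → x * (y * z) ≡ y * (x * z)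
    x*[y*z]≡y*[x*z] = solve-∀

  -- cross w x w′ x′ detects the 4-cycle w x w′ x′ with w, w′ ∈ S, x, x′ ∉ S, apart from its edges
  -- wx and w′x′; crossings f g collects it over the orientations of f = wx and g = w′x′.
  cross : Fin n → Fin n → Fin n → Fin n → ℕ
  cross w x w′ x′ = inS w * outS x * (inS w′ * outS x′ * (adj w x′ * adj x w′))

  crossings : Fin m → Fin m → ℕ
  crossings f g = (cross (end₁ f) (end₂ f) (end₁ g) (end₂ g) + cross (end₁ f) (end₂ f) (end₂ g) (end₁ g))
                + (cross (end₂ f) (end₁ f) (end₁ g) (end₂ g) + cross (end₂ f) (end₁ f) (end₂ g) (end₁ g))

  leaving≤touchesS : ∀ s t → 𝟙 s * 𝟙 (not t) + 𝟙 t * 𝟙 (not s) ≤ 𝟙 (s ∨ t)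
  leaving≤touchesS true  true  = z≤n
  leaving≤touchesS true  false = ≤-refl
  leaving≤touchesS false true  = ≤-refl
  leaving≤touchesS false false = z≤n

  crossings≤doublyLinked : ∀ f g → crossings f g ≤ doublyLinked f g
  -- At most one orientation of an edge leads from S out of S, and a 4-cycle through f and g supplies
  -- two different adjacent endpoint pairs, so links f g ≥ 2.
  crossings≤doublyLinked f g = begin
    crossings f g
      ≡⟨ regroup₁ (σ₁ f) (σ₂ f) (σ₁ g) (σ₂ g) A₁ A₂ A₃ A₄ ⟩
    (σ₁ f * (σ₁ g * (A₂ * A₃)) + σ₁ f * (σ₂ g * (A₁ * A₄))) + (σ₂ f * (σ₁ g * (A₁ * A₄)) + σ₂ f * (σ₂ g * (A₂ * A₃)))
      ≤⟨ +-mono-≤ (+-mono-≤ (bound (σ₁ f) (σ₁ g) A₂A₃≤L) (bound (σ₁ f) (σ₂ g) A₁A₄≤L))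
                  (+-mono-≤ (bound (σ₂ f) (σ₁ g) A₁A₄≤L) (bound (σ₂ f) (σ₂ g) A₂A₃≤L)) ⟩
    (σ₁ f * (σ₁ g * L) + σ₁ f * (σ₂ g * L)) + (σ₂ f * (σ₁ g * L) + σ₂ f * (σ₂ g * L))
      ≡⟨ regroup₂ (σ₁ f) (σ₂ f) (σ₁ g) (σ₂ g) L ⟩
    (σ₁ f + σ₂ f) * (σ₁ g + σ₂ g) * L
      ≤⟨ *-monoˡ-≤ L (*-mono-≤ (leaving≤touchesS (S (end₁ f)) (S (end₂ f))) (leaving≤touchesS (S (end₁ g)) (S (end₂ g)))) ⟩
    doublyLinked f g ∎
    where
    open ≤-Reasoning
    σ₁ σ₂ : Fin m → ℕ
    σ₁ h = inS (end₁ h) * outS (end₂ h)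
    σ₂ h = inS (end₂ h) * outS (end₁ h)
    A₁ = adj (end₁ f) (end₁ g)
    A₂ = adj (end₁ f) (end₂ g)
    A₃ = adj (end₂ f) (end₁ g)
    A₄ = adj (end₂ f) (end₂ g)
    L = atLeast₂ (links f g)
    A₂A₃≤L : A₂ * A₃ ≤ L
    A₂A₃≤L = ≤-trans (x*y≤atLeast₂[x+y] (𝟙≤1 (Adjacent (end₁ f) (end₂ g))) (𝟙≤1 (Adjacent (end₂ f) (end₁ g)))) (atLeast₂-mono
      (≤-trans (≤-trans (m≤n+m (A₂ + A₃) A₁) (≤-reflexive (sym (+-assoc A₁ A₂ A₃)))) (m≤m+n _ A₄)))
    A₁A₄≤L : A₁ * A₄ ≤ L
    A₁A₄≤L = ≤-trans (x*y≤atLeast₂[x+y] (𝟙≤1 (Adjacent (end₁ f) (end₁ g))) (𝟙≤1 (Adjacent (end₂ f) (end₂ g)))) (atLeast₂-mono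
      (+-monoˡ-≤ A₄ (≤-trans (m≤m+n A₁ A₂) (m≤m+n _ A₃))))
    bound : ∀ a b {p} → p ≤ L → a * (b * p) ≤ a * (b * L)
    bound a b p≤L = *-monoʳ-≤ a (*-monoʳ-≤ b p≤L)
    regroup₁ : ∀ s₁ s₂ t₁ t₂ a₁ a₂ a₃ a₄ →
      (s₁ * (t₁ * (a₂ * a₃)) + s₁ * (t₂ * (a₁ * a₄))) + (s₂ * (t₁ * (a₄ * a₁)) + s₂ * (t₂ * (a₃ * a₂))) ≡
      (s₁ * (t₁ * (a₂ * a₃)) + s₁ * (t₂ * (a₁ * a₄))) + (s₂ * (t₁ * (a₁ * a₄)) + s₂ * (t₂ * (a₂ * a₃)))
    regroup₁ = solve-∀
    regroup₂ : ∀ s₁ s₂ t₁ t₂ l → (s₁ * (t₁ * l) + s₁ * (t₂ * l)) + (s₂ * (t₁ * l) + s₂ * (t₂ * l)) ≡ (s₁ + s₂) * (t₁ + t₂) * l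
    regroup₂ = solve-∀

  weightedCrossings : (Fin n → Fin n → ℕ) → ℕ
  weightedCrossings μ = ∑∑ (λ w′ x′ → μ w′ x′ * ∑∑ (λ w x → μ w x * cross w x w′ x′))

  ∑∑crossings≡ : ∑∑ crossings ≡ weightedCrossings multiplicity
  ∑∑crossings≡ = begin
    ∑∑ crossings
      ≡⟨ sum-cong-≗ (λ f → trans (sum-cong-≗ (λ g → regroup (cross (end₁ f) (end₂ f) (end₁ g) (end₂ g)) (cross (end₁ f) (end₂ f) (end₂ g) (end₁ g))
                                                             (cross (end₂ f) (end₁ f) (end₁ g) (end₂ g)) (cross (end₂ f) (end₁ f) (end₂ g) (end₁ g))))
                                 (∑-edges (ψ f))) ⟩
    sum (λ f → ∑∑ (λ w′ x′ → multiplicity w′ x′ * ψ f w′ x′))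
      ≡⟨ ∑-comm (λ f w′ → sum (λ x′ → multiplicity w′ x′ * ψ f w′ x′)) ⟩
    sum (λ w′ → sum (λ f → sum (λ x′ → multiplicity w′ x′ * ψ f w′ x′)))
      ≡⟨ sum-cong-≗ (λ w′ → ∑-comm (λ f x′ → multiplicity w′ x′ * ψ f w′ x′)) ⟩
    ∑∑ (λ w′ x′ → sum (λ f → multiplicity w′ x′ * ψ f w′ x′))
      ≡⟨ sum-cong-≗ (λ w′ → sum-cong-≗ (λ x′ → trans (sym (*-distribˡ-sum (multiplicity w′ x′) (λ f → ψ f w′ x′)))
                                                    (cong (multiplicity w′ x′ *_) (∑-edges (λ w x → cross w x w′ x′))))) ⟩
    weightedCrossings multiplicity ∎
    where
    open ≡-Reasoning
    ψ : Fin m → Fin n → Fin n → ℕ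
    ψ f w′ x′ = cross (end₁ f) (end₂ f) w′ x′ + cross (end₂ f) (end₁ f) w′ x′
    regroup : ∀ a b c d → (a + b) + (c + d) ≡ (a + c) + (b + d)
    regroup = solve-∀

  weightedCrossings-adj≡C4 : weightedCrossings adj ≡ C4
  weightedCrossings-adj≡C4 = begin
    ∑∑ (λ w′ x′ → adj w′ x′ * ∑∑ (λ w x → adj w x * cross w x w′ x′))
      ≡⟨ sum-cong-≗ (λ w′ → sum-cong-≗ (λ x′ → trans (*-distribˡ-sum (adj w′ x′) (λ w → sum (λ x → adj w x * cross w x w′ x′)))
                                                    (sum-cong-≗ (λ w → *-distribˡ-sum (adj w′ x′) (λ x → adj w x * cross w x w′ x′))))) ⟩
    sum (λ w′ → sum (λ x′ → ∑∑ (λ w x → term w′ x′ w x)))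
      ≡⟨ sum-cong-≗ (λ w′ → ∑-comm (λ x′ w → sum (λ x → term w′ x′ w x))) ⟩
    sum (λ w′ → sum (λ w → ∑∑ (λ x′ x → term w′ x′ w x)))
      ≡⟨ ∑-comm (λ w′ w → ∑∑ (λ x′ x → term w′ x′ w x)) ⟩
    sum (λ w → sum (λ w′ → ∑∑ (λ x′ x → term w′ x′ w x)))
      ≡⟨ sum-cong-≗ (λ w → sum-cong-≗ (λ w′ → ∑-comm (λ x′ x → term w′ x′ w x))) ⟩
    sum (λ w → sum (λ w′ → ∑∑ (λ x x′ → term w′ x′ w x)))
      ≡⟨ sum-cong-≗ (λ w → sum-cong-≗ (λ w′ → at w w′)) ⟩
    sum (λ w → sum (λ w′ → inS w * (inS w′ * (common w w′ * common w w′))))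
      ≡⟨ sum-cong-≗ (λ w → sym (*-distribˡ-sum (inS w) (λ w′ → inS w′ * (common w w′ * common w w′)))) ⟩
    C4 ∎
    where
    open ≡-Reasoning
    term : Fin n → Fin n → Fin n → Fin n → ℕ
    term w′ x′ w x = adj w′ x′ * (adj w x * cross w x w′ x′)
    walk : Fin n → Fin n → Fin n → ℕ
    walk w w′ x = outS x * adj w x * adj w′ x
    regroup : ∀ a₁ a₂ a₃ a₄ s n s′ n′ → a₁ * (a₂ * (s * n * (s′ * n′ * (a₃ * a₄)))) ≡ s * (s′ * (n * a₂ * a₄ * (n′ * a₃ * a₁)))
    regroup = solve-∀
    pointwise : ∀ w w′ x x′ → term w′ x′ w x ≡ inS w * (inS w′ * (walk w w′ x * walk w w′ x′))
    pointwise w w′ x x′ rewrite adj-sym x w′ =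
      regroup (adj w′ x′) (adj w x) (adj w x′) (adj w′ x) (inS w) (outS x) (inS w′) (outS x′)
    at : ∀ w w′ → ∑∑ (λ x x′ → term w′ x′ w x) ≡ inS w * (inS w′ * (common w w′ * common w w′))
    at w w′ = begin
      ∑∑ (λ x x′ → term w′ x′ w x)                               ≡⟨ sum-cong-≗ (λ x → sum-cong-≗ (pointwise w w′ x)) ⟩
      ∑∑ (λ x x′ → inS w * (inS w′ * (walk w w′ x * walk w w′ x′))) ≡⟨ sym (*-distribˡ-∑∑ (inS w) (λ x x′ → inS w′ * (walk w w′ x * walk w w′ x′))) ⟩
      inS w * ∑∑ (λ x x′ → inS w′ * (walk w w′ x * walk w w′ x′))   ≡⟨ cong (inS w *_) (sym (*-distribˡ-∑∑ (inS w′) (λ x x′ → walk w w′ x * walk w w′ x′))) ⟩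
      inS w * (inS w′ * ∑∑ (λ x x′ → walk w w′ x * walk w w′ x′))   ≡⟨ cong (λ z → inS w * (inS w′ * z)) (sym (sum-*-sum (walk w w′) (walk w w′))) ⟩
      inS w * (inS w′ * (common w w′ * common w w′))                ∎

  C4≤∑∑doublyLinked : C4 ≤ ∑∑ doublyLinked
  C4≤∑∑doublyLinked = begin
    C4                                ≡⟨ sym weightedCrossings-adj≡C4 ⟩
    weightedCrossings adj             ≤⟨ ∑∑-mono-≤ (λ w′ x′ → *-mono-≤ (adj≤multiplicity w′ x′)
                                                      (∑∑-mono-≤ (λ w x → *-monoˡ-≤ (cross w x w′ x′) (adj≤multiplicity w x)))) ⟩
    weightedCrossings multiplicity    ≡⟨ sym ∑∑crossings≡ ⟩
    ∑∑ crossings                      ≤⟨ ∑∑-mono-≤ crossings≤doublyLinked ⟩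
    ∑∑ doublyLinked                   ∎
    where open ≤-Reasoning

module UpperBound (G : Multigraph) (e : Fin (Multigraph.m G)) {Δ : ℕ} (Δ-bound : MaxDegree≤ G Δ) where
  open Multigraph G
  open Adjacency G
  open BoundedDegree G Δ-bound
  open AroundEdge G e

  degS≤Δ : ∀ a → degS a ≤ Δ
  degS≤Δ a = ≤-trans (sum-mono-≤ touches≤1) (∑incidence≤Δ a)
    where
    touches≤1 : ∀ f → touchesS f * incidence f a ≤ incidence f a
    touches≤1 f = ≤-trans (*-monoˡ-≤ (incidence f a) (𝟙≤1 (TouchesS f))) (≤-reflexive (*-identityˡ (incidence f a)))

  χ≤Δ² : ∀ a → χ a ≤ Δ * Δ
  χ≤Δ² a = ∑-adj-≤-Δ* a degS Δ degS≤Δ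

  |S|≤2Δ : sum inS ≤ 2 * Δ
  |S|≤2Δ = begin
    sum inS                                            ≤⟨ sum-mono-≤ (λ a → 𝟙-∨ (Adjacent (end₁ e) a) (Adjacent (end₂ e) a)) ⟩
    sum (λ a → adj (end₁ e) a + adj (end₂ e) a)         ≡⟨ ∑-distrib-+ (adj (end₁ e)) (adj (end₂ e)) ⟩
    sum (adj (end₁ e)) + sum (adj (end₂ e))             ≤⟨ +-mono-≤ (∑adj≤Δ (end₁ e)) (∑adj≤Δ (end₂ e)) ⟩
    Δ + Δ                                              ≡⟨ cong (_+_ Δ) (sym (+-identityʳ Δ)) ⟩
    2 * Δ                                              ∎
    where open ≤-Reasoning

  edge-at-vertex-outside-S : ∀ x y sx sy → (T x → sx ≡ false) → (T y → sy ≡ false) → (T x → T y → ⊥) →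
    𝟙 (sx ∨ sy) * (𝟙 x + 𝟙 y) + (𝟙 x * 𝟙 (not sy) + 𝟙 y * 𝟙 (not sx)) ≤ 𝟙 x + 𝟙 y
  edge-at-vertex-outside-S true  true  _  _  _     _     x∧y = ⊥-elim (x∧y _ _)
  edge-at-vertex-outside-S true  false sx sy x⇒¬sx _     _   rewrite x⇒¬sx _ with sy
  ... | true  = ≤-refl
  ... | false = ≤-refl
  edge-at-vertex-outside-S false true  sx sy _     y⇒¬sy _   rewrite y⇒¬sy _ with sx
  ... | true  = ≤-refl
  ... | false = ≤-refl
  edge-at-vertex-outside-S false false sx sy _     _     _   = ≤-reflexive (trans (+-identityʳ _) (*-zeroʳ (𝟙 (sx ∨ sy))))

  degS+outNbrs≤Δ : ∀ a → S a ≡ false → degS a + outNbrs a ≤ Δ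
  degS+outNbrs≤Δ a a∉S = begin
    degS a + outNbrs a
      ≤⟨ +-monoʳ-≤ (degS a) outNbrs≤ ⟩
    degS a + sum (λ f → 𝟙 (end₁ f ≡ᵇ a) * outS (end₂ f) + 𝟙 (end₂ f ≡ᵇ a) * outS (end₁ f))
      ≡⟨ sym (∑-distrib-+ (λ f → touchesS f * incidence f a) _) ⟩
    sum (λ f → touchesS f * incidence f a + (𝟙 (end₁ f ≡ᵇ a) * outS (end₂ f) + 𝟙 (end₂ f ≡ᵇ a) * outS (end₁ f)))
      ≤⟨ sum-mono-≤ (λ f → edge-at-vertex-outside-S (end₁ f ≡ᵇ a) (end₂ f ≡ᵇ a) (S (end₁ f)) (S (end₂ f))
                             (end-outside-S (end₁ f)) (end-outside-S (end₂ f))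
                             (λ h₁ h₂ → loopless f (trans (toWitness h₁) (sym (toWitness h₂))))) ⟩
    sum (λ f → incidence f a)
      ≤⟨ ∑incidence≤Δ a ⟩
    Δ ∎
    where
    open ≤-Reasoning
    end-outside-S : ∀ x → T (x ≡ᵇ a) → S x ≡ false
    end-outside-S x x≡a = trans (cong S (toWitness x≡a)) a∉S
    outNbrs≤ : outNbrs a ≤ sum (λ f → 𝟙 (end₁ f ≡ᵇ a) * outS (end₂ f) + 𝟙 (end₂ f ≡ᵇ a) * outS (end₁ f))
    outNbrs≤ = ≤-trans (≤-reflexive (sum-cong-≗ (λ b → *-comm (outS b) (adj a b)))) (∑-adj-≤ a outS)

  ∑inS*χ*degS≤2Δ⁴ : sum (λ a → inS a * (χ a * degS a)) ≤ 2 * Δ * (Δ * Δ * Δ)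
  ∑inS*χ*degS≤2Δ⁴ = begin
    sum (λ a → inS a * (χ a * degS a))  ≤⟨ sum-mono-≤ (λ a → *-monoʳ-≤ (inS a) (*-mono-≤ (χ≤Δ² a) (degS≤Δ a))) ⟩
    sum (λ a → inS a * (Δ * Δ * Δ))     ≡⟨ sym (*-distribʳ-sum (Δ * Δ * Δ) inS) ⟩
    sum inS * (Δ * Δ * Δ)               ≤⟨ *-monoˡ-≤ (Δ * Δ * Δ) |S|≤2Δ ⟩
    2 * Δ * (Δ * Δ * Δ)                 ∎
    where open ≤-Reasoning

  χ≤inNbrs*Δ+χout : ∀ a → χ a ≤ inNbrs a * Δ + χout a
  χ≤inNbrs*Δ+χout a = begin
    χ a                                                              ≡⟨ split-S (λ b → adj a b * degS b) ⟩
    sum (λ b → inS b * (adj a b * degS b)) + sum (λ b → outS b * (adj a b * degS b))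
                                                                     ≤⟨ +-monoˡ-≤ _ ∑in≤ ⟩
    inNbrs a * Δ + χout a                                            ∎
    where
    open ≤-Reasoning
    ∑in≤ : sum (λ b → inS b * (adj a b * degS b)) ≤ inNbrs a * Δ
    ∑in≤ = begin
      sum (λ b → inS b * (adj a b * degS b)) ≤⟨ sum-mono-≤ (λ b → ≤-trans (≤-reflexive (sym (*-assoc (inS b) (adj a b) (degS b))))
                                                                       (*-monoʳ-≤ (inS b * adj a b) (degS≤Δ b))) ⟩
      sum (λ b → inS b * adj a b * Δ)        ≡⟨ sym (*-distribʳ-sum Δ (λ b → inS b * adj a b)) ⟩
      inNbrs a * Δ                           ∎

  ∑outS*χ*degS≤ : sum (λ a → outS a * (χ a * degS a)) ≤
                  sum (λ a → outS a * (Δ * degS a * inNbrs a + degS a * degS a * outNbrs a))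
  ∑outS*χ*degS≤ = begin
    sum (λ a → outS a * (χ a * degS a))
      ≤⟨ sum-mono-≤ (λ a → *-monoʳ-≤ (outS a) (*-monoˡ-≤ (degS a) (χ≤inNbrs*Δ+χout a))) ⟩
    sum (λ a → outS a * ((inNbrs a * Δ + χout a) * degS a))
      ≡⟨ sum-cong-≗ (λ a → regroup (outS a) (inNbrs a) Δ (χout a) (degS a)) ⟩
    sum (λ a → outS a * (Δ * degS a * inNbrs a) + outS a * (χout a * degS a))
      ≡⟨ ∑-distrib-+ (λ a → outS a * (Δ * degS a * inNbrs a)) (λ a → outS a * (χout a * degS a)) ⟩
    sum (λ a → outS a * (Δ * degS a * inNbrs a)) + sum (λ a → outS a * (χout a * degS a))
      ≤⟨ +-monoʳ-≤ (sum (λ a → outS a * (Δ * degS a * inNbrs a))) ∑outS*χout*degS≤ ⟩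
    sum (λ a → outS a * (Δ * degS a * inNbrs a)) + sum (λ a → outS a * (degS a * degS a * outNbrs a))
      ≡⟨ sym (∑-distrib-+ (λ a → outS a * (Δ * degS a * inNbrs a)) (λ a → outS a * (degS a * degS a * outNbrs a))) ⟩
    sum (λ a → outS a * (Δ * degS a * inNbrs a) + outS a * (degS a * degS a * outNbrs a))
      ≡⟨ sum-cong-≗ (λ a → sym (*-distribˡ-+ (outS a) (Δ * degS a * inNbrs a) (degS a * degS a * outNbrs a))) ⟩
    sum (λ a → outS a * (Δ * degS a * inNbrs a + degS a * degS a * outNbrs a)) ∎
    where
    open ≤-Reasoning
    regroup : ∀ o t Δ X d → o * ((t * Δ + X) * d) ≡ o * (Δ * d * t) + o * (X * d)
    regroup = solve-∀

  outside-vertex-bound : ∀ a → 16 * (outS a * (Δ * degS a * inNbrs a + degS a * degS a * outNbrs a)) ≤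
                                9 * (Δ * Δ) * (outS a * degS a) + 8 * Δ * (outS a * (inNbrs a * inNbrs a))
  outside-vertex-bound a with S a in a∈S?
  ... | true  = ≤-reflexive (sym (cong₂ _+_ (*-zeroʳ (9 * (Δ * Δ))) (*-zeroʳ (8 * Δ))))
  ... | false = begin
    16 * (1 * (Δ * degS a * inNbrs a + degS a * degS a * outNbrs a))
      ≡⟨ cong (16 *_) (*-identityˡ (Δ * degS a * inNbrs a + degS a * degS a * outNbrs a)) ⟩
    16 * (Δ * degS a * inNbrs a + degS a * degS a * outNbrs a)
      ≤⟨ 16[Δmt+m²k]≤9Δ²m+8Δt² Δ (degS a) (inNbrs a) (outNbrs a) (degS+outNbrs≤Δ a a∈S?) ⟩
    9 * (Δ * Δ) * degS a + 8 * Δ * (inNbrs a * inNbrs a)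
      ≡⟨ sym (cong₂ _+_ (cong (9 * (Δ * Δ) *_) (*-identityˡ (degS a))) (cong (8 * Δ *_) (*-identityˡ (inNbrs a * inNbrs a)))) ⟩
    9 * (Δ * Δ) * (1 * degS a) + 8 * Δ * (1 * (inNbrs a * inNbrs a)) ∎
    where open ≤-Reasoning

  16*∑χ*degS≤ : 16 * sum (λ a → χ a * degS a) ≤ 32 * (Δ * Δ * Δ * Δ) + (9 * (Δ * Δ) * P + 8 * Δ * Y)
  16*∑χ*degS≤ = begin
    16 * sum (λ a → χ a * degS a)
      ≡⟨ cong (16 *_) (split-S (λ a → χ a * degS a)) ⟩
    16 * (sum (λ a → inS a * (χ a * degS a)) + sum (λ a → outS a * (χ a * degS a)))
      ≡⟨ *-distribˡ-+ 16 (sum (λ a → inS a * (χ a * degS a))) _ ⟩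
    16 * sum (λ a → inS a * (χ a * degS a)) + 16 * sum (λ a → outS a * (χ a * degS a))
      ≤⟨ +-mono-≤ (*-monoʳ-≤ 16 ∑inS*χ*degS≤2Δ⁴) (*-monoʳ-≤ 16 ∑outS*χ*degS≤) ⟩
    16 * (2 * Δ * (Δ * Δ * Δ)) + 16 * sum vertexTerm
      ≡⟨ cong₂ _+_ (32Δ⁴ Δ) (*-distribˡ-sum 16 vertexTerm) ⟩
    32 * (Δ * Δ * Δ * Δ) + sum (λ a → 16 * vertexTerm a)
      ≤⟨ +-monoʳ-≤ (32 * (Δ * Δ * Δ * Δ)) (sum-mono-≤ outside-vertex-bound) ⟩
    32 * (Δ * Δ * Δ * Δ) + sum (λ a → 9 * (Δ * Δ) * (outS a * degS a) + 8 * Δ * (outS a * (inNbrs a * inNbrs a)))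
      ≡⟨ cong (_+_ (32 * (Δ * Δ * Δ * Δ))) (trans (∑-distrib-+ (λ a → 9 * (Δ * Δ) * (outS a * degS a)) _)
            (sym (cong₂ _+_ (*-distribˡ-sum (9 * (Δ * Δ)) (λ a → outS a * degS a))
                            (*-distribˡ-sum (8 * Δ) (λ a → outS a * (inNbrs a * inNbrs a)))))) ⟩
    32 * (Δ * Δ * Δ * Δ) + (9 * (Δ * Δ) * P + 8 * Δ * Y) ∎
    where
    open ≤-Reasoning
    vertexTerm : Fin n → ℕ
    vertexTerm a = outS a * (Δ * degS a * inNbrs a + degS a * degS a * outNbrs a)
    32Δ⁴ : ∀ Δ → 16 * (2 * Δ * (Δ * Δ * Δ)) ≡ 32 * (Δ * Δ * Δ * Δ)
    32Δ⁴ = solve-∀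

  touchesS*outside≤inside : ∀ sx sy → 𝟙 (sx ∨ sy) * (𝟙 (not sx) + 𝟙 (not sy)) ≤ 1 * (𝟙 sx + 𝟙 sy)
  touchesS*outside≤inside true  true  = z≤n
  touchesS*outside≤inside true  false = s≤s z≤n
  touchesS*outside≤inside false true  = s≤s z≤n
  touchesS*outside≤inside false false = z≤n

  P≤2Δ² : P ≤ 2 * Δ * Δ
  P≤2Δ² = begin
    P                                                      ≡⟨ sym (∑-endpoints touchesS outS) ⟩
    sum (λ f → touchesS f * (outS (end₁ f) + outS (end₂ f))) ≤⟨ sum-mono-≤ (λ f → touchesS*outside≤inside (S (end₁ f)) (S (end₂ f))) ⟩
    sum (λ f → 1 * (inS (end₁ f) + inS (end₂ f)))          ≡⟨ ∑-endpoints (λ _ → 1) inS ⟩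
    sum (λ a → inS a * sum (λ f → 1 * incidence f a))      ≤⟨ sum-mono-≤ (λ a → *-monoʳ-≤ (inS a) deg≤Δ) ⟩
    sum (λ a → inS a * Δ)                                  ≡⟨ sym (*-distribʳ-sum Δ inS) ⟩
    sum inS * Δ                                            ≤⟨ *-monoˡ-≤ Δ |S|≤2Δ ⟩
    2 * Δ * Δ                                              ∎
    where
    open ≤-Reasoning
    deg≤Δ : ∀ {a} → sum (λ f → 1 * incidence f a) ≤ Δ
    deg≤Δ {a} = ≤-trans (≤-reflexive (sum-cong-≗ (λ f → *-identityˡ (incidence f a)))) (∑incidence≤Δ a)

ε : ℚ
ε = + 1 / 16

ε-positive : Positive ε
ε-positive = _

16a≤15c⇒a≤[1-ε]c : ∀ a c → 16 * a ≤ 15 * c → + a / 1 Q.≤ (1ℚ - ε) Q.* (+ c / 1)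
-- Both sides are compared as unnormalised fractions a/1 and 15c/16, i.e. by cross-multiplication.
16a≤15c⇒a≤[1-ε]c a c 16a≤15c = ℚP.toℚᵘ-cancel-≤
  (ℚᵘP.≤-respˡ-≃ (ℚᵘP.≃-sym (ℚP.toℚᵘ-fromℚᵘ (ℚᵘ.mkℚᵘ (+ a) 0)))
  (ℚᵘP.≤-respʳ-≃ (ℚᵘP.≃-sym (ℚP.toℚᵘ-homo-* (1ℚ - ε) (+ c / 1)))
  (ℚᵘP.≤-respʳ-≃ (ℚᵘP.*-congˡ {ℚᵘ.mkℚᵘ (+ 15) 15} (ℚᵘP.≃-sym (ℚP.toℚᵘ-fromℚᵘ (ℚᵘ.mkℚᵘ (+ c) 0))))
  (ℚᵘ.*≤* (subst₂ ℤ._≤_ (ℤP.pos-* a 16) cross-multiplied (+≤+ a*16≤15*c*1))))))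
  where
  a*16≤15*c*1 : a * 16 ≤ 15 * c * 1
  a*16≤15*c*1 = subst₂ _≤_ (*-comm 16 a) (sym (*-identityʳ _)) 16a≤15c
  cross-multiplied : + (15 * c * 1) ≡ (+ 15 ℤ.* + c) ℤ.* + 1
  cross-multiplied = trans (ℤP.pos-* (15 * c) 1) (cong (ℤ._* + 1) (ℤP.pos-* 15 c))

16*inducedNbhdEdges≤27Δ⁴ : ∀ {Δ} (G : Multigraph) → MaxDegree≤ G Δ → (e : Fin (Multigraph.m G)) →
  16 * inducedNbhdEdges G e ≤ 27 * (Δ * Δ * Δ * Δ)
16*inducedNbhdEdges≤27Δ⁴ {Δ} G Δ-bound e = absorb-cross-term Δ (inducedNbhdEdges G e) C4 Y upper lower
  where
  open AroundEdge G e
  open UpperBound G e Δ-bound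
  upper : 16 * (2 * inducedNbhdEdges G e + C4) ≤ 50 * (Δ * Δ * Δ * Δ) + 8 * Δ * Y
  upper = begin
    16 * (2 * inducedNbhdEdges G e + C4)
      ≤⟨ *-monoʳ-≤ 16 (+-mono-≤ 2*inducedNbhdEdges≤∑∑linked C4≤∑∑doublyLinked) ⟩
    16 * (∑∑ linked + ∑∑ doublyLinked)
      ≤⟨ *-monoʳ-≤ 16 ∑∑linked+∑∑doublyLinked≤∑∑totalLinks ⟩
    16 * ∑∑ totalLinks
      ≡⟨ cong (16 *_) ∑∑totalLinks≡∑χ*degS ⟩
    16 * sum (λ a → χ a * degS a)
      ≤⟨ 16*∑χ*degS≤ ⟩
    32 * (Δ * Δ * Δ * Δ) + (9 * (Δ * Δ) * P + 8 * Δ * Y)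
      ≤⟨ +-monoʳ-≤ (32 * (Δ * Δ * Δ * Δ)) (+-monoˡ-≤ (8 * Δ * Y) (*-monoʳ-≤ (9 * (Δ * Δ)) P≤2Δ²)) ⟩
    32 * (Δ * Δ * Δ * Δ) + (9 * (Δ * Δ) * (2 * Δ * Δ) + 8 * Δ * Y)
      ≡⟨ collect Δ Y ⟩
    50 * (Δ * Δ * Δ * Δ) + 8 * Δ * Y ∎
    where
    open ≤-Reasoning
    collect : ∀ Δ Y → 32 * (Δ * Δ * Δ * Δ) + (9 * (Δ * Δ) * (2 * Δ * Δ) + 8 * Δ * Y) ≡ 50 * (Δ * Δ * Δ * Δ) + 8 * Δ * Y
    collect = solve-∀
  lower : Y * Y ≤ (2 * Δ) * (2 * Δ) * C4
  lower = ≤-trans Y²≤|S|²*C4 (*-monoˡ-≤ C4 (*-mono-≤ |S|≤2Δ |S|≤2Δ))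

open Multigraph using (m)

lemma4p3 : Σ ℚ λ ε → Σ ℕ λ Δ₀ → Positive ε ×
    ((Δ : ℕ) → Δ ≥ Δ₀ → (F : Multigraph) → MaxDegree≤ F Δ → (e : Fin (m F)) →
      (+ inducedNbhdEdges F e) / 1 Q.≤ (1ℚ - ε) Q.* ((+ ((2 * (Δ * (Δ ∸ 1))) C 2)) / 1))
lemma4p3 = ε , 30 , ε-positive , λ Δ 30≤Δ F Δ-bound e →
  16a≤15c⇒a≤[1-ε]c (inducedNbhdEdges F e) ((2 * (Δ * (Δ ∸ 1))) C 2)
    (≤-trans (16*inducedNbhdEdges≤27Δ⁴ F Δ-bound e) (27Δ⁴≤15*[2Δ[Δ∸1]C2] Δ 30≤Δ))
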